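{- Let $\mathbf d=(d_1,\ldots,d_n)$ be a degree sequence with $M=\sum_i d_i$, $M_2=\sum_i d_i(d_i-1)$, $\Delta=\max_i d_i$. Let $G\in\mathcal G_{0,m_2}$ with $m_2\le M_2^2/M^2$. Then $$M_2-8m_2\Delta\le b_d(G,\emptyset)\le M_2,$$ for every simple ordered 2-path $(v_1,v_2,v_3)$ in $G$, $$M_2-4m_2(2\Delta-3)-3\Delta^3\le b_d(G,v_1v_2v_3)\le M_2,$$ and $$2m_2M^2\Bigl(1-\frac{12\Delta^2-4\Delta+8}{M}\Bigr)\le f_d(G)\le 2m_2M^2.$$
   Context: $\mathcal G_{0,m_2}$ is the set of multigraphs on $\{v_1,\ldots,v_n\}$ with degree sequence $\mathbf d$ having no loops, exactly $m_2$ double edges (pairs of distinct vertices joined by exactly two parallel edges) and no pair of vertices joined by three or more edges. A single edge is a pair of distinct vertices joined by exactly one edge; a non-edge is a pair of distinct vertices joined by no edge. A simple ordered 2-path $uvw$ is an ordered triple $(u,v,w)$ of distinct vertices with $uv$ and $vw$ single edges. $b_d(G,\emptyset)$ is the number of simple ordered 2-paths in $G$. For a simple ordered 2-path $uvw$, $b_d(G,uvw)$ is the number of simple ordered 2-paths $u'v'w'$ with $u',v',w'\notin\{u,v,w\}$ such that $uu'$, $vv'$ and $ww'$ are non-edges. $f_d(G)$ is the number of ordered 6-tuples $(v_1,\ldots,v_6)$ of distinct vertices such that $v_2v_5$ is a double edge, $v_1v_4$ and $v_3v_6$ are single edges, and $v_1v_2$, $v_2v_3$, $v_4v_5$, $v_5v_6$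 are non-edges (the number of ways to perform a $d$-switching, which replaces the double edge $v_2v_5$ and edges $v_1v_4,v_3v_6$ by $v_1v_2,v_2v_3,v_4v_5,v_5v_6$). -}

module Defs where

open import Data.Nat using (ℕ; zero; suc; _+_; _*_; _∸_; _≤_; _<_; _⊔_)
open import Data.Fin using (Fin; toℕ; _≟_)
open import Data.List using (List; map; allFin; foldr)
open import Data.Nat.ListAction using (sum)
open import Data.Product using (_×_)
open import Data.Bool using (Bool; true; false; if_then_else_; _∧_; not)
open import Relation.Nullary.Decidable using (⌊_⌋)
open import Relation.Binary.PropositionalEquality using (_≡_; _≢_)
import Data.Nat as N

sumF : ∀ {n} → (Fin n → ℕ) → ℕ
sumF {n} f = sum (map f (allFin n))

ind : Bool → ℕ
ind true = 1
ind false = 0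

record MultiGraph (n : ℕ) : Set where
  field
    mult     : Fin n → Fin n → ℕ
    mult-sym : ∀ i j → mult i j ≡ mult j i
    loopless : ∀ i → mult i i ≡ 0
open MultiGraph public

module _ {n : ℕ} (G : MultiGraph n) where
  eqb : Fin n → Fin n → Bool
  eqb i j = ⌊ i ≟ j ⌋

  neqb : Fin n → Fin n → Bool
  neqb i j = not (eqb i j)

  isMult : ℕ → Fin n → Fin n → Bool
  isMult k i j = ⌊ mult G i j N.≟ k ⌋

  single : Fin n → Fin n → Bool
  single = isMult 1

  double : Fin n → Fin n → Bool
  double = isMult 2

  nonEdge : Fin n → Fin n → Bool
  nonEdge = isMult 0

  degree : Fin n → ℕ
  degree i = sumF (λ j → mult G i j)

  -- number of double edges (unordered pairs {i,j}, counted with i < j)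
  numDouble : ℕ
  numDouble = sumF λ i → sumF λ j → ind (⌊ toℕ i N.<? toℕ j ⌋ ∧ double i j)

  s2p : Fin n → Fin n → Fin n → Bool
  s2p u v w = neqb u v ∧ neqb v w ∧ neqb u w ∧ single u v ∧ single v w

  bEmpty : ℕ
  bEmpty = sumF λ u → sumF λ v → sumF λ w → ind (s2p u v w)

  notIn3 : Fin n → Fin n → Fin n → Fin n → Bool
  notIn3 u v w x = neqb x u ∧ neqb x v ∧ neqb x w

  bPath : Fin n → Fin n → Fin n → ℕ
  bPath u v w = sumF λ u' → sumF λ v' → sumF λ w' →
    ind (s2p u' v' w' ∧ notIn3 u v w u' ∧ notIn3 u v w v' ∧ notIn3 u v w w'
         ∧ nonEdge u u' ∧ nonEdge v v' ∧ nonEdge w w')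

  allDistinct6 : Fin n → Fin n → Fin n → Fin n → Fin n → Fin n → Bool
  allDistinct6 a b c d e f =
    neqb a b ∧ neqb a c ∧ neqb a d ∧ neqb a e ∧ neqb a f ∧
    neqb b c ∧ neqb b d ∧ neqb b e ∧ neqb b f ∧
    neqb c d ∧ neqb c e ∧ neqb c f ∧
    neqb d e ∧ neqb d f ∧
    neqb e f

  fd : ℕ
  fd = sumF λ x1 → sumF λ x2 → sumF λ x3 → sumF λ x4 → sumF λ x5 → sumF λ x6 →
    ind (allDistinct6 x1 x2 x3 x4 x5 x6 ∧ double x2 x5 ∧ single x1 x4 ∧ single x3 x6
         ∧ nonEdge x1 x2 ∧ nonEdge x2 x3 ∧ nonEdge x4 x5 ∧ nonEdge x5 x6)

IsSimple2Path : ∀ {n} → MultiGraph n → Fin n → Fin n → Fin n → Set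
IsSimple2Path G u v w = s2p G u v w ≡ true

InG0 : ∀ {n} → (Fin n → ℕ) → ℕ → MultiGraph n → Set
InG0 {n} d m₂ G =
  (∀ i → degree G i ≡ d i) × ((∀ i j → mult G i j ≤ 2) × (numDouble G ≡ m₂))

Msum : ∀ {n} → (Fin n → ℕ) → ℕ
Msum d = sumF d

M2sum : ∀ {n} → (Fin n → ℕ) → ℕ
M2sum d = sumF λ i → d i * (d i ∸ 1)

maxDeg : ∀ {n} → (Fin n → ℕ) → ℕ
maxDeg {n} d = foldr _⊔_ 0 (map d (allFin n))

module Submission where

-- b(G,∅): grouping 2-paths uvw by their centre v, a vertex with s single and t
-- double edges is the centre of s² − s of them, while its degree is s + 2t; this
-- gives b ≤ M₂ and, summing the deficits, M₂ + 12m₂ ≤ b + 8m₂Δ.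
-- b(G,uvw): a 2-path not counted by b(G,uvw) has a "blocked" first vertex, centre
-- or last vertex; at most Δ + 1 vertices are blocked in each role and each lies on
-- at most Δ(Δ − 1) paths in that role, so b(G,∅) ≤ b(G,uvw) + 3(Δ + 1)Δ(Δ − 1).
-- f_d: the candidate configurations (a double edge and two ordered single edges)
-- number 2m₂·SS², SS = M − 4m₂; a candidate fails to be a d-switching only through
-- one of 4 adjacencies or 8 coincidences, each of weight at most SS·Δ² or SS·Δ.
-- Together with m₂ ≤ (Δ − 1)² (from the hypothesis) this yields the lower bound.

open import Defs

module Counting where

  open import Data.Nat using (ℕ; zero; suc; _+_; _*_; _∸_; _≤_; _⊔_; z≤n; s≤s)
  open import Data.Nat.Properties
    using ( +-*-semiring; +-assoc; +-comm; +-identityʳ; +-cancelʳ-≡; +-cancelʳ-≤; +-mono-≤; +-monoˡ-≤; +-monoʳ-≤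
          ; *-assoc; *-comm; *-identityˡ; *-zeroʳ; *-distribˡ-+; *-distribʳ-+; *-cancelʳ-≤; *-mono-≤; *-monoˡ-≤
          ; *-monoʳ-≤; ≤-refl; ≤-reflexive; ≤-trans; ≤-antisym; <-asym; ≮⇒≥; m≤m+n; m≤n+m; m≤m*n; m*n≢0
          ; m≤m⊔n; m≤n⊔m; m+[n∸m]≡n; m+n∸n≡m; m+n≡0⇒m≡0; m+n≡0⇒n≡0; ∸-monoˡ-≤; module ≤-Reasoning )
  import Data.Nat as ℕ
  open import Data.Fin using (Fin; toℕ; _≟_) renaming (zero to fzero; suc to fsuc)
  open import Data.Fin.Properties using (toℕ-injective) renaming (suc-injective to fsuc-injective)
  open import Data.List using (List; []; _∷_; foldr; tabulate; length)
  open import Data.List.Properties using (map-tabulate)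
  open import Data.List.Relation.Unary.Any using (here; there)
  open import Data.List.Relation.Unary.All using (All; []; _∷_)
  open import Data.List.Membership.Propositional using (_∈_)
  open import Data.List.Membership.Propositional.Properties using (∈-map⁺; ∈-allFin)
  import Data.Nat.ListAction as List
  open import Data.Bool using (Bool; true; false; _∧_; not)
  open import Data.Bool.Properties using (∧-idem; ∧-zeroʳ; ∧-identityʳ; ∧-comm)
  open import Data.Product using (_×_; _,_; proj₁; proj₂)
  open import Data.Empty using (⊥-elim)
  open import Function using (_∘_; id)
  open import Relation.Nullary.Decidable using (⌊_⌋; yes; no)
  open import Relation.Binary.PropositionalEquality
  open import Data.Nat.Tactic.RingSolver using (solve-∀)
  open import Algebra.Properties.Semiring.Sum +-*-semiring
    using (sum; sum-cong-≗; ∑-distrib-+; ∑-comm; *-distribˡ-sum; *-distribʳ-sum; sum-replicate-zero)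

  sumF≡sum : ∀ {n} (f : Fin n → ℕ) → sumF f ≡ sum f
  sumF≡sum f = trans (cong List.sum (map-tabulate id f)) (sum-tabulate f)
    where
    sum-tabulate : ∀ {n} (f : Fin n → ℕ) → List.sum (tabulate f) ≡ sum f
    sum-tabulate {zero}  f = refl
    sum-tabulate {suc n} f = cong (f fzero +_) (sum-tabulate (f ∘ fsuc))

  sum-mono : ∀ {n} {f g : Fin n → ℕ} → (∀ i → f i ≤ g i) → sum f ≤ sum g
  sum-mono {zero}  f≤g = z≤n
  sum-mono {suc n} f≤g = +-mono-≤ (f≤g fzero) (sum-mono (f≤g ∘ fsuc))

  sum-zero : ∀ {n} {f : Fin n → ℕ} → (∀ i → f i ≡ 0) → sum f ≡ 0
  sum-zero {n} f≡0 = trans (sum-cong-≗ f≡0) (sum-replicate-zero n)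

  sum-point : ∀ {n} (f : Fin n → ℕ) (i : Fin n) → (∀ j → i ≢ j → f j ≡ 0) → sum f ≡ f i
  sum-point {suc n} f fzero vanish =
    trans (cong (f fzero +_) (sum-zero (λ j → vanish (fsuc j) (λ ())))) (+-identityʳ (f fzero))
  sum-point {suc n} f (fsuc i) vanish =
    trans (cong (_+ sum (f ∘ fsuc)) (vanish fzero (λ ())))
          (sum-point (f ∘ fsuc) i (λ j i≢j → vanish (fsuc j) (i≢j ∘ fsuc-injective)))

  ∑² : ∀ {n} → (Fin n → Fin n → ℕ) → ℕ
  ∑² F = sum (λ a → sum (λ b → F a b))

  ∑²-mono : ∀ {n} {F H : Fin n → Fin n → ℕ} → (∀ a b → F a b ≤ H a b) → ∑² F ≤ ∑² H
  ∑²-mono F≤H = sum-mono (λ a → sum-mono (F≤H a))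

  ∑²-distrib-+ : ∀ {n} (F H : Fin n → Fin n → ℕ) → ∑² (λ a b → F a b + H a b) ≡ ∑² F + ∑² H
  ∑²-distrib-+ F H = trans (sum-cong-≗ (λ a → ∑-distrib-+ (F a) (H a))) (∑-distrib-+ (λ a → sum (F a)) (λ a → sum (H a)))

  ∑²-*ˡ : ∀ {n} (x : ℕ) (F : Fin n → Fin n → ℕ) → ∑² (λ a b → x * F a b) ≡ x * ∑² F
  ∑²-*ˡ x F = trans (sum-cong-≗ (λ a → sym (*-distribˡ-sum x (F a)))) (sym (*-distribˡ-sum x (λ a → sum (F a))))

  ∑²-*ʳ : ∀ {n} (x : ℕ) (F : Fin n → Fin n → ℕ) → ∑² (λ a b → F a b * x) ≡ ∑² F * x
  ∑²-*ʳ x F = trans (sum-cong-≗ (λ a → sym (*-distribʳ-sum x (F a)))) (sym (*-distribʳ-sum x (λ a → sum (F a))))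

  ∑³ : ∀ {n} → (Fin n → Fin n → Fin n → ℕ) → ℕ
  ∑³ F = sum (λ a → sum (λ b → sum (λ c → F a b c)))

  sumF³≡∑³ : ∀ {n} (F : Fin n → Fin n → Fin n → ℕ) → sumF (λ a → sumF (λ b → sumF (F a b))) ≡ ∑³ F
  sumF³≡∑³ F = trans (sumF≡sum (λ a → sumF (λ b → sumF (F a b))))
                     (sum-cong-≗ (λ a → trans (sumF≡sum (λ b → sumF (F a b))) (sum-cong-≗ (λ b → sumF≡sum (F a b)))))

  ∑³-mono : ∀ {n} {F H : Fin n → Fin n → Fin n → ℕ} → (∀ a b c → F a b c ≤ H a b c) → ∑³ F ≤ ∑³ H
  ∑³-mono F≤H = sum-mono (λ a → sum-mono (λ b → sum-mono (F≤H a b)))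

  ∑³-distrib-+ : ∀ {n} (F H : Fin n → Fin n → Fin n → ℕ) → ∑³ (λ a b c → F a b c + H a b c) ≡ ∑³ F + ∑³ H
  ∑³-distrib-+ F H =
    trans (sum-cong-≗ (λ a → trans (sum-cong-≗ (λ b → ∑-distrib-+ (F a b) (H a b)))
                                   (∑-distrib-+ (λ b → sum (F a b)) (λ b → sum (H a b)))))
          (∑-distrib-+ (λ a → sum (λ b → sum (F a b))) (λ a → sum (λ b → sum (H a b))))

  ∑³-reverse : ∀ {n} (F : Fin n → Fin n → Fin n → ℕ) → ∑³ F ≡ ∑³ (λ c b a → F a b c)
  ∑³-reverse F =
    trans (∑-comm (λ a b → sum (F a b)))
    (trans (sum-cong-≗ (λ b → ∑-comm (λ a c → F a b c)))
           (∑-comm (λ b c → sum (λ a → F a b c))))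

  ∑³-split : ∀ {n} (X Y Z : Fin n → ℕ) (F : Fin n → Fin n → Fin n → ℕ) →
    ∑³ (λ a b c → (X a + Y b + Z c) * F a b c)
      ≡ ∑³ (λ a b c → X a * F a b c) + ∑³ (λ a b c → Y b * F a b c) + ∑³ (λ a b c → Z c * F a b c)
  ∑³-split X Y Z F = begin
    ∑³ (λ a b c → (X a + Y b + Z c) * F a b c)
      ≡⟨ sum-cong-≗ (λ a → sum-cong-≗ (λ b → sum-cong-≗ (λ c →
           trans (*-distribʳ-+ (F a b c) (X a + Y b) (Z c)) (cong (_+ Z c * F a b c) (*-distribʳ-+ (F a b c) (X a) (Y b)))))) ⟩
    ∑³ (λ a b c → X a * F a b c + Y b * F a b c + Z c * F a b c)
      ≡⟨ ∑³-distrib-+ (λ a b c → X a * F a b c + Y b * F a b c) (λ a b c → Z c * F a b c) ⟩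
    ∑³ (λ a b c → X a * F a b c + Y b * F a b c) + ∑³ (λ a b c → Z c * F a b c)
      ≡⟨ cong (_+ ∑³ (λ a b c → Z c * F a b c)) (∑³-distrib-+ (λ a b c → X a * F a b c) (λ a b c → Y b * F a b c)) ⟩
    ∑³ (λ a b c → X a * F a b c) + ∑³ (λ a b c → Y b * F a b c) + ∑³ (λ a b c → Z c * F a b c) ∎
    where open ≡-Reasoning

  ∈⇒≤max : ∀ {x} {xs : List ℕ} → x ∈ xs → x ≤ foldr _⊔_ 0 xs
  ∈⇒≤max (here refl)   = m≤m⊔n _ _
  ∈⇒≤max (there x∈xs) = ≤-trans (∈⇒≤max x∈xs) (m≤n⊔m _ _)

  ≤maxDeg : ∀ {n} (d : Fin n → ℕ) (i : Fin n) → d i ≤ maxDeg d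
  ≤maxDeg d i = ∈⇒≤max (∈-map⁺ d (∈-allFin i))

  _≡ᵇ_ : ∀ {n} → Fin n → Fin n → Bool
  i ≡ᵇ j = ⌊ i ≟ j ⌋

  ≡ᵇ-refl : ∀ {n} (i : Fin n) → i ≡ᵇ i ≡ true
  ≡ᵇ-refl i with i ≟ i
  ... | yes _  = refl
  ... | no i≢i = ⊥-elim (i≢i refl)

  ≢⇒≡ᵇ-false : ∀ {n} {i j : Fin n} → i ≢ j → i ≡ᵇ j ≡ false
  ≢⇒≡ᵇ-false {i = i} {j} i≢j with i ≟ j
  ... | yes i≡j = ⊥-elim (i≢j i≡j)
  ... | no _    = refl

  ≡ᵇ⇒≡ : ∀ {n} {i j : Fin n} → i ≡ᵇ j ≡ true → i ≡ j
  ≡ᵇ⇒≡ {i = i} {j} eq with i ≟ j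
  ... | yes i≡j = i≡j

  ≡ᵇ-false⇒≢ : ∀ {n} {i j : Fin n} → i ≡ᵇ j ≡ false → i ≢ j
  ≡ᵇ-false⇒≢ {i = i} i≢j refl with trans (sym (≡ᵇ-refl i)) i≢j
  ... | ()

  ≡ᵇ-sym : ∀ {n} (i j : Fin n) → i ≡ᵇ j ≡ j ≡ᵇ i
  ≡ᵇ-sym i j with i ≟ j | j ≟ i
  ... | yes _   | yes _   = refl
  ... | no _    | no _    = refl
  ... | yes i≡j | no j≢i  = ⊥-elim (j≢i (sym i≡j))
  ... | no i≢j  | yes j≡i = ⊥-elim (i≢j (sym j≡i))

  ind≤1 : ∀ b → ind b ≤ 1
  ind≤1 true  = ≤-refl
  ind≤1 false = z≤n

  ind-∧ : ∀ a b → ind (a ∧ b) ≡ ind a * ind b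
  ind-∧ true  b = sym (*-identityˡ (ind b))
  ind-∧ false b = refl

  ind-∧-≤ˡ : ∀ a b → ind (a ∧ b) ≤ ind a
  ind-∧-≤ˡ true  b = ind≤1 b
  ind-∧-≤ˡ false b = z≤n

  ind-∧-≤ʳ : ∀ a b → ind (a ∧ b) ≤ ind b
  ind-∧-≤ʳ true  b = ≤-refl
  ind-∧-≤ʳ false b = z≤n

  ind≡0 : ∀ b → ind b ≡ 0 → b ≡ false
  ind≡0 false _ = refl

  ind-not≡0 : ∀ r → ind (not r) ≡ 0 → r ≡ true
  ind-not≡0 true _ = refl

  ind-unless≡0 : ∀ c r → ind (not c ∧ not r) ≡ 0 → c ≡ false → r ≡ true
  ind-unless≡0 false true _ _ = refl

  ∧-true : ∀ x y → x ∧ y ≡ true → x ≡ true × y ≡ true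
  ∧-true true true _ = refl , refl

  refute : ∀ {b p} → (b ≡ true → p ≡ false) → p ≡ true → b ≡ false
  refute {false} _ _ = refl
  refute {true}  b⇒¬p p with trans (sym p) (b⇒¬p refl)
  ... | ()

  count-point : ∀ {n} (i : Fin n) (P : Fin n → Bool) → sum (λ j → ind (i ≡ᵇ j ∧ P j)) ≡ ind (P i)
  count-point i P =
    trans (sum-point _ i (λ j i≢j → cong (λ b → ind (b ∧ P j)) (≢⇒≡ᵇ-false i≢j)))
          (cong (λ b → ind (b ∧ P i)) (≡ᵇ-refl i))

  count-eq : ∀ {n} (u : Fin n) → sum (λ a → ind (a ≡ᵇ u)) ≡ 1
  count-eq u = trans (sum-cong-≗ (λ a → trans (cong ind (≡ᵇ-sym a u)) (cong ind (sym (∧-identityʳ (u ≡ᵇ a))))))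
                     (count-point u (λ _ → true))

  count-remove : ∀ {n} (i : Fin n) (P : Fin n → Bool) →
    sum (λ j → ind (P j)) ≡ sum (λ j → ind (not (i ≡ᵇ j) ∧ P j)) + ind (P i)
  count-remove i P = begin
    sum (λ j → ind (P j))                                            ≡⟨ sum-cong-≗ (λ j → split (i ≡ᵇ j) (P j)) ⟩
    sum (λ j → ind (not (i ≡ᵇ j) ∧ P j) + ind (i ≡ᵇ j ∧ P j))        ≡⟨ ∑-distrib-+ (λ j → ind (not (i ≡ᵇ j) ∧ P j)) (λ j → ind (i ≡ᵇ j ∧ P j)) ⟩
    sum (λ j → ind (not (i ≡ᵇ j) ∧ P j)) + sum (λ j → ind (i ≡ᵇ j ∧ P j)) ≡⟨ cong (sum (λ j → ind (not (i ≡ᵇ j) ∧ P j)) +_) (count-point i P) ⟩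
    sum (λ j → ind (not (i ≡ᵇ j) ∧ P j)) + ind (P i)                 ∎
    where
    open ≡-Reasoning
    split : ∀ b p → ind p ≡ ind (not b ∧ p) + ind (b ∧ p)
    split true  p = refl
    split false p = sym (+-identityʳ (ind p))

  ordered-pairs : ∀ {n} (A : Fin n → Bool) →
    sum (λ u → sum (λ w → ind (not (u ≡ᵇ w) ∧ (A u ∧ A w)))) + sum (λ u → ind (A u))
      ≡ sum (λ u → ind (A u)) * sum (λ u → ind (A u))
  ordered-pairs A = begin
    sum (λ u → sum (λ w → ind (not (u ≡ᵇ w) ∧ (A u ∧ A w)))) + sum (λ u → ind (A u))
      ≡⟨ ∑-distrib-+ (λ u → sum (λ w → ind (not (u ≡ᵇ w) ∧ (A u ∧ A w)))) (λ u → ind (A u)) ⟨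
    sum (λ u → sum (λ w → ind (not (u ≡ᵇ w) ∧ (A u ∧ A w))) + ind (A u))
      ≡⟨ sum-cong-≗ row ⟩
    sum (λ u → ind (A u) * c)
      ≡⟨ *-distribʳ-sum c (λ u → ind (A u)) ⟨
    c * c ∎
    where
    open ≡-Reasoning
    c = sum (λ u → ind (A u))
    row : ∀ u → sum (λ w → ind (not (u ≡ᵇ w) ∧ (A u ∧ A w))) + ind (A u) ≡ ind (A u) * c
    row u = begin
      sum (λ w → ind (not (u ≡ᵇ w) ∧ (A u ∧ A w))) + ind (A u)
        ≡⟨ cong (sum (λ w → ind (not (u ≡ᵇ w) ∧ (A u ∧ A w))) +_) (cong ind (∧-idem (A u))) ⟨
      sum (λ w → ind (not (u ≡ᵇ w) ∧ (A u ∧ A w))) + ind (A u ∧ A u)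
        ≡⟨ count-remove u (λ w → A u ∧ A w) ⟨
      sum (λ w → ind (A u ∧ A w))
        ≡⟨ sum-cong-≗ (λ w → ind-∧ (A u) (A w)) ⟩
      sum (λ w → ind (A u) * ind (A w))
        ≡⟨ *-distribˡ-sum (ind (A u)) (λ w → ind (A w)) ⟨
      ind (A u) * c ∎

  union-bound : ∀ (a r : Bool) (F : ℕ) → (a ≡ true → F ≡ 0 → r ≡ true) → ind a ≤ ind (a ∧ r) + F * ind a
  union-bound false r F _     = z≤n
  union-bound true  r zero    good rewrite good refl refl = ≤-refl
  union-bound true  r (suc F) _ = ≤-trans (s≤s z≤n) (m≤n+m (suc F * 1) (ind r))

  module _ {n : ℕ} (G : MultiGraph n) where

    isMult-sym : ∀ k i j → isMult G k i j ≡ isMult G k j i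
    isMult-sym k i j = cong (λ m → ⌊ m ℕ.≟ k ⌋) (mult-sym G i j)

    edge⇒distinct : ∀ k i j → isMult G (suc k) i j ≡ true → i ≡ᵇ j ≡ false
    edge⇒distinct k i j isEdge with i ≟ j
    ... | no _ = refl
    ... | yes refl with trans (sym isEdge) (cong (λ m → ⌊ m ℕ.≟ suc k ⌋) (loopless G i))
    ...   | ()

    edge⇒adjacent : ∀ k i j → isMult G (suc k) i j ≡ true → nonEdge G i j ≡ false
    edge⇒adjacent k i j = positive (mult G i j)
      where
      positive : ∀ m → ⌊ m ℕ.≟ suc k ⌋ ≡ true → ⌊ m ℕ.≟ 0 ⌋ ≡ false
      positive (suc m) _ = refl

    deg : Fin n → ℕ
    deg v = sum (mult G v)

    sdeg : Fin n → ℕ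
    sdeg v = sum (λ j → ind (single G v j))

    ddeg : Fin n → ℕ
    ddeg v = sum (λ j → ind (double G v j))

    degree≡deg : ∀ v → degree G v ≡ deg v
    degree≡deg v = sumF≡sum (mult G v)

    sdeg≤deg : ∀ v → sdeg v ≤ deg v
    sdeg≤deg v = sum-mono (λ j → single≤mult (mult G v j))
      where
      single≤mult : ∀ m → ind ⌊ m ℕ.≟ 1 ⌋ ≤ m
      single≤mult zero    = z≤n
      single≤mult (suc m) = ≤-trans (ind≤1 _) (s≤s z≤n)

    neighbours≤deg : ∀ v → sum (λ j → ind (not (nonEdge G v j))) ≤ deg v
    neighbours≤deg v = sum-mono (λ j → adjacent≤mult (mult G v j))
      where
      adjacent≤mult : ∀ m → ind (not ⌊ m ℕ.≟ 0 ⌋) ≤ m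
      adjacent≤mult zero    = z≤n
      adjacent≤mult (suc m) = s≤s z≤n

    sum-ddeg : sum ddeg ≡ 2 * numDouble G
    sum-ddeg = begin
      sum ddeg
        ≡⟨ sum-cong-≗ (λ i → trans (sum-cong-≗ (orient i)) (∑-distrib-+ (λ j → ind (i <ᵇ j ∧ double G i j)) (λ j → ind (j <ᵇ i ∧ double G i j)))) ⟩
      sum (λ i → N i + sum (λ j → ind (j <ᵇ i ∧ double G i j)))
        ≡⟨ ∑-distrib-+ N (λ i → sum (λ j → ind (j <ᵇ i ∧ double G i j))) ⟩
      sum N + sum (λ i → sum (λ j → ind (j <ᵇ i ∧ double G i j)))
        ≡⟨ cong (sum N +_) (∑-comm (λ i j → ind (j <ᵇ i ∧ double G i j))) ⟩
      sum N + sum (λ j → sum (λ i → ind (j <ᵇ i ∧ double G i j)))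
        ≡⟨ cong (sum N +_) (sum-cong-≗ (λ j → sum-cong-≗ (λ i → cong (λ b → ind (j <ᵇ i ∧ b)) (isMult-sym 2 i j)))) ⟩
      sum N + sum N
        ≡⟨ cong (sum N +_) (+-identityʳ (sum N)) ⟨
      2 * sum N
        ≡⟨ cong (2 *_) numDouble≡ ⟨
      2 * numDouble G ∎
      where
      open ≡-Reasoning
      _<ᵇ_ : Fin n → Fin n → Bool
      i <ᵇ j = ⌊ toℕ i ℕ.<? toℕ j ⌋

      N : Fin n → ℕ
      N i = sum (λ j → ind (i <ᵇ j ∧ double G i j))

      numDouble≡ : numDouble G ≡ sum N
      numDouble≡ = trans (sumF≡sum (λ i → sumF (λ j → ind (i <ᵇ j ∧ double G i j))))
                         (sum-cong-≗ (λ i → sumF≡sum (λ j → ind (i <ᵇ j ∧ double G i j))))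

      one-order : ∀ i j → i ≢ j → ind (i <ᵇ j) + ind (j <ᵇ i) ≡ 1
      one-order i j i≢j with toℕ i ℕ.<? toℕ j | toℕ j ℕ.<? toℕ i
      ... | yes i<j | yes j<i = ⊥-elim (<-asym i<j j<i)
      ... | yes _   | no _    = refl
      ... | no _    | yes _   = refl
      ... | no i≮j  | no j≮i  = ⊥-elim (i≢j (toℕ-injective (≤-antisym (≮⇒≥ j≮i) (≮⇒≥ i≮j))))

      orient : ∀ i j → ind (double G i j) ≡ ind (i <ᵇ j ∧ double G i j) + ind (j <ᵇ i ∧ double G i j)
      orient i j with double G i j in isDouble
      ... | false = sym (cong₂ _+_ (cong ind (∧-zeroʳ (i <ᵇ j))) (cong ind (∧-zeroʳ (j <ᵇ i))))
      ... | true  = sym (trans (cong₂ _+_ (cong ind (∧-identityʳ (i <ᵇ j))) (cong ind (∧-identityʳ (j <ᵇ i))))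
                               (one-order i j (≡ᵇ-false⇒≢ (edge⇒distinct 1 i j isDouble))))

    module _ (mult≤2 : ∀ i j → mult G i j ≤ 2) where

      mult-split : ∀ i j → mult G i j ≡ ind (single G i j) + 2 * ind (double G i j)
      mult-split i j = split (mult G i j) (mult≤2 i j)
        where
        split : ∀ m → m ≤ 2 → m ≡ ind ⌊ m ℕ.≟ 1 ⌋ + 2 * ind ⌊ m ℕ.≟ 2 ⌋
        split 0 _ = refl
        split 1 _ = refl
        split 2 _ = refl
        split (suc (suc (suc _))) (s≤s (s≤s ()))

      deg-split : ∀ v → deg v ≡ sdeg v + 2 * ddeg v
      deg-split v = begin
        sum (mult G v)                                         ≡⟨ sum-cong-≗ (mult-split v) ⟩
        sum (λ j → ind (single G v j) + 2 * ind (double G v j)) ≡⟨ ∑-distrib-+ (λ j → ind (single G v j)) (λ j → 2 * ind (double G v j)) ⟩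
        sdeg v + sum (λ j → 2 * ind (double G v j))            ≡⟨ cong (sdeg v +_) (*-distribˡ-sum 2 (λ j → ind (double G v j))) ⟨
        sdeg v + 2 * ddeg v                                    ∎
        where open ≡-Reasoning

  n≤n*n : ∀ n → n ≤ n * n
  n≤n*n zero    = z≤n
  n≤n*n (suc n) = m≤m*n (suc n) (suc n)

  pred-square : ∀ x → x * (x ∸ 1) + x ≡ x * x
  pred-square zero    = refl
  pred-square (suc x) = lemma x
    where
    lemma : ∀ x → suc x * x + suc x ≡ suc x * suc x
    lemma = solve-∀

  -- A vertex with s single and t double edges has degree D = s + 2t.  If p = s² − s
  -- is its number of ordered pairs of distinct single neighbours, then
  -- D(D−1) + 2t = p + 4t(s + t).
  pairs-identity : ∀ s t p → p + s ≡ s * s → (s + 2 * t) * (s + 2 * t ∸ 1) + 2 * t ≡ p + 4 * t * (s + t)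
  pairs-identity s t p p+s≡s² = +-cancelʳ-≡ s _ _ (begin
    D * (D ∸ 1) + 2 * t + s     ≡⟨ reorder (D * (D ∸ 1)) s t ⟩
    D * (D ∸ 1) + D             ≡⟨ pred-square D ⟩
    D * D                       ≡⟨ square s t ⟩
    s * s + 4 * t * (s + t)     ≡⟨ cong (_+ 4 * t * (s + t)) p+s≡s² ⟨
    p + s + 4 * t * (s + t)     ≡⟨ swap-last p s (4 * t * (s + t)) ⟩
    p + 4 * t * (s + t) + s     ∎)
    where
    open ≡-Reasoning
    D = s + 2 * t
    reorder : ∀ x s t → x + 2 * t + s ≡ x + (s + 2 * t)
    reorder = solve-∀
    square : ∀ s t → (s + 2 * t) * (s + 2 * t) ≡ s * s + 4 * t * (s + t)
    square = solve-∀
    swap-last : ∀ x y z → x + y + z ≡ x + z + y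
    swap-last = solve-∀

  pairs≤ : ∀ s t p → p + s ≡ s * s → p ≤ (s + 2 * t) * (s + 2 * t ∸ 1)
  pairs≤ s t p p+s≡s² = +-cancelʳ-≤ (2 * t) p ((s + 2 * t) * (s + 2 * t ∸ 1)) (begin
    p + 2 * t                             ≤⟨ +-monoʳ-≤ p 2t≤4t[s+t] ⟩
    p + 4 * t * (s + t)                   ≡⟨ pairs-identity s t p p+s≡s² ⟨
    (s + 2 * t) * (s + 2 * t ∸ 1) + 2 * t ∎)
    where
    open ≤-Reasoning
    2t≤4t[s+t] : 2 * t ≤ 4 * t * (s + t)
    2t≤4t[s+t] = begin
      2 * t           ≤⟨ *-monoʳ-≤ 2 (n≤n*n t) ⟩
      2 * (t * t)     ≤⟨ *-monoˡ-≤ (t * t) (s≤s (s≤s (z≤n {2}))) ⟩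
      4 * (t * t)     ≤⟨ *-monoʳ-≤ 4 (*-monoʳ-≤ t (m≤n+m t s)) ⟩
      4 * (t * (s + t)) ≡⟨ *-assoc 4 t (s + t) ⟨
      4 * t * (s + t) ∎

  pairs-deficit : ∀ s t p Δ → p + s ≡ s * s → s + 2 * t ≤ Δ →
                  (s + 2 * t) * (s + 2 * t ∸ 1) + 6 * t ≤ p + 4 * t * Δ
  pairs-deficit s t p Δ p+s≡s² D≤Δ = begin
    (s + 2 * t) * (s + 2 * t ∸ 1) + 6 * t       ≡⟨ split-6t ((s + 2 * t) * (s + 2 * t ∸ 1)) t ⟩
    (s + 2 * t) * (s + 2 * t ∸ 1) + 2 * t + 4 * t ≡⟨ cong (_+ 4 * t) (pairs-identity s t p p+s≡s²) ⟩
    p + 4 * t * (s + t) + 4 * t                 ≤⟨ +-monoʳ-≤ (p + 4 * t * (s + t)) (*-monoʳ-≤ 4 (n≤n*n t)) ⟩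
    p + 4 * t * (s + t) + 4 * (t * t)           ≡⟨ regroup p s t ⟩
    p + 4 * t * (s + 2 * t)                     ≤⟨ +-monoʳ-≤ p (*-monoʳ-≤ (4 * t) D≤Δ) ⟩
    p + 4 * t * Δ                               ∎
    where
    open ≤-Reasoning
    split-6t : ∀ x t → x + 6 * t ≡ x + 2 * t + 4 * t
    split-6t = solve-∀
    regroup : ∀ p s t → p + 4 * t * (s + t) + 4 * (t * t) ≡ p + 4 * t * (s + 2 * t)
    regroup = solve-∀

  module _ {n : ℕ} (G : MultiGraph n) where

    s2p-centre : ∀ u v w → s2p G u v w ≡ (not (u ≡ᵇ w) ∧ (single G v u ∧ single G v w))
    s2p-centre u v w =
      trans (drop-implied (neqb G u v) (neqb G v w) (not (u ≡ᵇ w)) (single G u v) (single G v w)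
                          (cong not ∘ edge⇒distinct G 0 u v) (cong not ∘ edge⇒distinct G 0 v w))
            (cong (λ b → not (u ≡ᵇ w) ∧ (b ∧ single G v w)) (isMult-sym G 1 u v))
      where
      drop-implied : ∀ a b c x y → (x ≡ true → a ≡ true) → (y ≡ true → b ≡ true) →
                     a ∧ b ∧ c ∧ x ∧ y ≡ c ∧ x ∧ y
      drop-implied a b c true  true  x⇒a y⇒b rewrite x⇒a refl | y⇒b refl = refl
      drop-implied a b c true  false x⇒a _   rewrite x⇒a refl | ∧-zeroʳ c | ∧-zeroʳ b = refl
      drop-implied a b c false y     _   _   rewrite ∧-zeroʳ c | ∧-zeroʳ b | ∧-zeroʳ a = refl

    s2p-edges : ∀ u v w → s2p G u v w ≡ true → single G u v ≡ true × single G v w ≡ true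
    s2p-edges u v w = edges (neqb G u v) (neqb G v w) (neqb G u w) (single G u v) (single G v w)
      where
      edges : ∀ p q r x y → p ∧ q ∧ r ∧ x ∧ y ≡ true → x ≡ true × y ≡ true
      edges true true true true true _ = refl , refl

    paths-at : Fin n → ℕ
    paths-at v = sum (λ u → sum (λ w → ind (s2p G u v w)))

    paths-at-count : ∀ v → paths-at v + sdeg G v ≡ sdeg G v * sdeg G v
    paths-at-count v = trans (cong (_+ sdeg G v) (sum-cong-≗ (λ u → sum-cong-≗ (λ w → cong ind (s2p-centre u v w)))))
                             (ordered-pairs (single G v))

    bEmpty-as-sum : bEmpty G ≡ ∑³ (λ u v w → ind (s2p G u v w))
    bEmpty-as-sum = sumF³≡∑³ (λ u v w → ind (s2p G u v w))

    bEmpty≡ : bEmpty G ≡ sum paths-at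
    bEmpty≡ = trans bEmpty-as-sum (∑-comm (λ u v → sum (λ w → ind (s2p G u v w))))

  M₂ : ∀ {n} → MultiGraph n → ℕ
  M₂ G = sum (λ v → deg G v * (deg G v ∸ 1))

  module _ {n : ℕ} (G : MultiGraph n) (mult≤2 : ∀ i j → mult G i j ≤ 2) where

    by-split : ∀ (P : ℕ → Set) v → P (sdeg G v + 2 * ddeg G v) → P (deg G v)
    by-split P v = subst P (sym (deg-split G mult≤2 v))

    paths-at≤ : ∀ v → paths-at G v ≤ deg G v * (deg G v ∸ 1)
    paths-at≤ v = by-split (λ D → paths-at G v ≤ D * (D ∸ 1)) v
                    (pairs≤ (sdeg G v) (ddeg G v) (paths-at G v) (paths-at-count G v))

    bEmpty≤M₂ : bEmpty G ≤ M₂ G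
    bEmpty≤M₂ = subst (_≤ M₂ G) (sym (bEmpty≡ G)) (sum-mono paths-at≤)

    module _ {Δ : ℕ} (deg≤Δ : ∀ v → deg G v ≤ Δ) where

      paths-at-deficit : ∀ v → deg G v * (deg G v ∸ 1) + 6 * ddeg G v ≤ paths-at G v + 4 * ddeg G v * Δ
      paths-at-deficit v =
        by-split (λ D → D * (D ∸ 1) + 6 * ddeg G v ≤ paths-at G v + 4 * ddeg G v * Δ) v
          (pairs-deficit (sdeg G v) (ddeg G v) (paths-at G v) Δ (paths-at-count G v)
                         (subst (_≤ Δ) (deg-split G mult≤2 v) (deg≤Δ v)))

      bEmpty-lower : M₂ G + 12 * numDouble G ≤ bEmpty G + 8 * numDouble G * Δ
      bEmpty-lower = begin
        M₂ G + 12 * numDouble G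
          ≡⟨ cong (M₂ G +_) (trans (*-assoc 6 2 m) (cong (6 *_) (sym (sum-ddeg G)))) ⟩
        M₂ G + 6 * sum (ddeg G)
          ≡⟨ cong (M₂ G +_) (*-distribˡ-sum 6 (ddeg G)) ⟩
        M₂ G + sum (λ v → 6 * ddeg G v)
          ≡⟨ ∑-distrib-+ (λ v → deg G v * (deg G v ∸ 1)) (λ v → 6 * ddeg G v) ⟨
        sum (λ v → deg G v * (deg G v ∸ 1) + 6 * ddeg G v)
          ≤⟨ sum-mono paths-at-deficit ⟩
        sum (λ v → paths-at G v + 4 * ddeg G v * Δ)
          ≡⟨ ∑-distrib-+ (paths-at G) (λ v → 4 * ddeg G v * Δ) ⟩
        sum (paths-at G) + sum (λ v → 4 * ddeg G v * Δ)
          ≡⟨ cong₂ _+_ (sym (bEmpty≡ G)) (sym (*-distribʳ-sum Δ (λ v → 4 * ddeg G v))) ⟩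
        bEmpty G + sum (λ v → 4 * ddeg G v) * Δ
          ≡⟨ cong (λ x → bEmpty G + x * Δ) (sym (*-distribˡ-sum 4 (ddeg G))) ⟩
        bEmpty G + 4 * sum (ddeg G) * Δ
          ≡⟨ cong (λ x → bEmpty G + 4 * x * Δ) (sum-ddeg G) ⟩
        bEmpty G + 4 * (2 * m) * Δ
          ≡⟨ cong (λ x → bEmpty G + x * Δ) (sym (*-assoc 4 2 m)) ⟩
        bEmpty G + 8 * m * Δ ∎
        where
        open ≤-Reasoning
        m = numDouble G

  weighted-sum≤ : ∀ {n} (T P : Fin n → ℕ) {c K : ℕ} → sum T ≤ c → (∀ a → P a ≤ K) → sum (λ a → T a * P a) ≤ c * K
  weighted-sum≤ T P {c} {K} ΣT≤c P≤K = begin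
    sum (λ a → T a * P a) ≤⟨ sum-mono (λ a → *-monoʳ-≤ (T a) (P≤K a)) ⟩
    sum (λ a → T a * K)   ≡⟨ *-distribʳ-sum K T ⟨
    sum T * K             ≤⟨ *-monoˡ-≤ K ΣT≤c ⟩
    c * K                 ∎
    where open ≤-Reasoning

  module _ {n : ℕ} (G : MultiGraph n) {Δ : ℕ} (deg≤Δ : ∀ v → deg G v ≤ Δ) where

    sdeg≤Δ : ∀ v → sdeg G v ≤ Δ
    sdeg≤Δ v = ≤-trans (sdeg≤deg G v) (deg≤Δ v)

    s2p-reverse : ∀ a b c → s2p G a b c ≡ s2p G c b a
    s2p-reverse a b c = begin
      s2p G a b c                                           ≡⟨ s2p-centre G a b c ⟩
      not (a ≡ᵇ c) ∧ (single G b a ∧ single G b c)          ≡⟨ cong₂ (λ x y → not x ∧ y) (≡ᵇ-sym a c) (∧-comm (single G b a) (single G b c)) ⟩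
      not (c ≡ᵇ a) ∧ (single G b c ∧ single G b a)          ≡⟨ s2p-centre G c b a ⟨
      s2p G c b a                                           ∎
      where open ≡-Reasoning

    paths-at≤Δ : ∀ b → paths-at G b ≤ Δ * (Δ ∸ 1)
    paths-at≤Δ b = begin
      paths-at G b                ≡⟨ +-cancelʳ-≡ s (paths-at G b) (s * (s ∸ 1)) (trans (paths-at-count G b) (sym (pred-square s))) ⟩
      s * (s ∸ 1)                 ≤⟨ *-mono-≤ (sdeg≤Δ b) (∸-monoˡ-≤ 1 (sdeg≤Δ b)) ⟩
      Δ * (Δ ∸ 1)                 ∎
      where
      open ≤-Reasoning
      s = sdeg G b

    starts-at : Fin n → ℕ
    starts-at a = sum (λ b → sum (λ c → ind (s2p G a b c)))

    starts-at≤Δ : ∀ a → starts-at a ≤ Δ * (Δ ∸ 1)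
    starts-at≤Δ a = begin
      starts-at a
        ≡⟨ sum-cong-≗ (λ b → sum-cong-≗ (λ c → cong ind (s2p-centre G a b c))) ⟩
      sum (λ b → sum (λ c → ind (not (a ≡ᵇ c) ∧ (single G b a ∧ single G b c))))
        ≤⟨ sum-mono (λ b → continuations b (single G b a) refl) ⟩
      sum (λ b → ind (single G b a) * (Δ ∸ 1))
        ≡⟨ *-distribʳ-sum (Δ ∸ 1) (λ b → ind (single G b a)) ⟨
      sum (λ b → ind (single G b a)) * (Δ ∸ 1)
        ≡⟨ cong (_* (Δ ∸ 1)) (sum-cong-≗ (λ b → cong ind (isMult-sym G 1 b a))) ⟩
      sdeg G a * (Δ ∸ 1)
        ≤⟨ *-monoˡ-≤ (Δ ∸ 1) (sdeg≤Δ a) ⟩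
      Δ * (Δ ∸ 1) ∎
      where
      open ≤-Reasoning
      -- a path a b · continues along one of the other single edges at b
      continuations : ∀ b x → x ≡ single G b a →
        sum (λ c → ind (not (a ≡ᵇ c) ∧ (x ∧ single G b c))) ≤ ind x * (Δ ∸ 1)
      continuations b false _ =
        ≤-reflexive (sum-zero (λ c → cong ind (∧-zeroʳ (not (a ≡ᵇ c)))))
      continuations b true ba = begin
        others                           ≡⟨ m+n∸n≡m others 1 ⟨
        others + 1 ∸ 1                   ≡⟨ cong (λ x → others + ind x ∸ 1) ba ⟩
        others + ind (single G b a) ∸ 1  ≡⟨ cong (_∸ 1) (count-remove a (single G b)) ⟨
        sdeg G b ∸ 1                     ≤⟨ ∸-monoˡ-≤ 1 (sdeg≤Δ b) ⟩
        Δ ∸ 1                            ≡⟨ +-identityʳ (Δ ∸ 1) ⟨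
        1 * (Δ ∸ 1)                      ∎
        where others = sum (λ c → ind (not (a ≡ᵇ c) ∧ single G b c))

    module _ (u v w : Fin n) (uv : single G u v ≡ true) (vw : single G v w ≡ true) where

      avoids : Fin n → Fin n → Fin n → Bool
      avoids a b c = notIn3 G u v w a ∧ notIn3 G u v w b ∧ notIn3 G u v w c
                     ∧ nonEdge G u a ∧ nonEdge G v b ∧ nonEdge G w c

      bPath-as-sum : bPath G u v w ≡ ∑³ (λ a b c → ind (s2p G a b c ∧ avoids a b c))
      bPath-as-sum = sumF³≡∑³ (λ a b c → ind (s2p G a b c ∧ avoids a b c))

      bPath≤bEmpty : bPath G u v w ≤ bEmpty G
      bPath≤bEmpty = subst₂ _≤_ (sym bPath-as-sum) (sym (bEmpty-as-sum G))
                            (∑³-mono (λ a b c → ind-∧-≤ˡ (s2p G a b c) (avoids a b c)))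

      -- a ≠ v is blocked as first vertex of abc (x₀ = u) or as last vertex (x₀ = w)
      blocked-end : Fin n → Fin n → ℕ
      blocked-end x₀ a = ind (not (a ≡ᵇ v) ∧ not (notIn3 G u v w a ∧ nonEdge G x₀ a))

      blocked-centre : Fin n → ℕ
      blocked-centre b = ind (not (notIn3 G u v w b ∧ nonEdge G v b))

      -- Blocked ends: u, w, and the at most Δ − 1 neighbours of x₀ other than v.
      blocked-end-count : ∀ x₀ → single G x₀ v ≡ true → sum (blocked-end x₀) ≤ Δ + 1
      blocked-end-count x₀ x₀v = begin
        sum (blocked-end x₀)
          ≤⟨ sum-mono (λ a → cases (a ≡ᵇ v) (a ≡ᵇ u) (a ≡ᵇ w) (nonEdge G x₀ a)) ⟩
        sum (λ a → ind (a ≡ᵇ u) + ind (a ≡ᵇ w) + ind (not (a ≡ᵇ v) ∧ not (nonEdge G x₀ a)))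
          ≡⟨ trans (∑-distrib-+ (λ a → ind (a ≡ᵇ u) + ind (a ≡ᵇ w)) (λ a → ind (not (a ≡ᵇ v) ∧ not (nonEdge G x₀ a))))
                   (cong₂ _+_ (trans (∑-distrib-+ (λ a → ind (a ≡ᵇ u)) (λ a → ind (a ≡ᵇ w))) (cong₂ _+_ (count-eq u) (count-eq w)))
                              (sum-cong-≗ (λ a → cong (λ x → ind (not x ∧ not (nonEdge G x₀ a))) (≡ᵇ-sym a v)))) ⟩
        2 + others
          ≤⟨ s≤s (subst (_≤ Δ) (+-comm others 1) others+1≤Δ) ⟩
        suc Δ
          ≡⟨ +-comm 1 Δ ⟩
        Δ + 1 ∎
        where
        open ≤-Reasoning
        others = sum (λ a → ind (not (v ≡ᵇ a) ∧ not (nonEdge G x₀ a)))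
        others+1≤Δ : others + 1 ≤ Δ
        others+1≤Δ = begin
          others + 1                                  ≡⟨ cong (λ x → others + ind (not x)) (edge⇒adjacent G 0 x₀ v x₀v) ⟨
          others + ind (not (nonEdge G x₀ v))         ≡⟨ count-remove v (λ a → not (nonEdge G x₀ a)) ⟨
          sum (λ a → ind (not (nonEdge G x₀ a)))      ≤⟨ neighbours≤deg G x₀ ⟩
          deg G x₀                                    ≤⟨ deg≤Δ x₀ ⟩
          Δ                                           ∎
        cases : ∀ x y z e → ind (not x ∧ not ((not y ∧ not x ∧ not z) ∧ e)) ≤ ind y + ind z + ind (not x ∧ not e)
        cases true  y     z     e = z≤n
        cases false true  z     e = s≤s z≤n
        cases false false true  e = s≤s z≤n
        cases false false false e = ≤-refl

      -- Blocked centres: v itself and the at most Δ neighbours of v (among them u, w).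
      blocked-centre-count : sum blocked-centre ≤ Δ + 1
      blocked-centre-count = begin
        sum blocked-centre
          ≤⟨ sum-mono (λ b → cases (b ≡ᵇ v) (b ≡ᵇ u) (b ≡ᵇ w) (nonEdge G v b)
                                 (λ b=u → subst (λ x → nonEdge G v x ≡ false) (sym (≡ᵇ⇒≡ b=u)) (edge⇒adjacent G 0 v u vu))
                                 (λ b=w → subst (λ x → nonEdge G v x ≡ false) (sym (≡ᵇ⇒≡ b=w)) (edge⇒adjacent G 0 v w vw))) ⟩
        sum (λ b → ind (b ≡ᵇ v) + ind (not (nonEdge G v b)))
          ≡⟨ trans (∑-distrib-+ (λ b → ind (b ≡ᵇ v)) (λ b → ind (not (nonEdge G v b))))
                   (cong (_+ sum (λ b → ind (not (nonEdge G v b)))) (count-eq v)) ⟩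
        1 + sum (λ b → ind (not (nonEdge G v b)))
          ≤⟨ s≤s (≤-trans (neighbours≤deg G v) (deg≤Δ v)) ⟩
        suc Δ
          ≡⟨ +-comm 1 Δ ⟩
        Δ + 1 ∎
        where
        open ≤-Reasoning
        vu : single G v u ≡ true
        vu = trans (isMult-sym G 1 v u) uv
        cases : ∀ x y z e → (y ≡ true → e ≡ false) → (z ≡ true → e ≡ false) →
                ind (not ((not y ∧ not x ∧ not z) ∧ e)) ≤ ind x + ind (not e)
        cases true  y     z     e _   _   = ≤-trans (ind≤1 _) (s≤s z≤n)
        cases false true  z     e y⇒e _   rewrite y⇒e refl = ≤-refl
        cases false false true  e _   z⇒e rewrite z⇒e refl = ≤-refl
        cases false false false e _   _   = ≤-refl

      unblocked⇒avoids : ∀ a b c → s2p G a b c ≡ true →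
                         blocked-end u a + blocked-centre b + blocked-end w c ≡ 0 → avoids a b c ≡ true
      unblocked⇒avoids a b c path none =
        assemble (proj₁ end-a) (proj₁ centre) (proj₁ end-c) (proj₂ end-a) (proj₂ centre) (proj₂ end-c)
        where
        assemble : ∀ {p q r s t z} → p ≡ true → q ≡ true → r ≡ true → s ≡ true → t ≡ true → z ≡ true →
                   p ∧ q ∧ r ∧ s ∧ t ∧ z ≡ true
        assemble refl refl refl refl refl refl = refl
        X = blocked-end u a
        Y = blocked-centre b
        Z = blocked-end w c
        X+Y≡0 : X + Y ≡ 0
        X+Y≡0 = m+n≡0⇒m≡0 (X + Y) none
        ab = proj₁ (s2p-edges G a b c path)
        bc = proj₂ (s2p-edges G a b c path)
        centre = ∧-true (notIn3 G u v w b) (nonEdge G v b)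
                   (ind-not≡0 (notIn3 G u v w b ∧ nonEdge G v b) (m+n≡0⇒n≡0 X X+Y≡0))
        a≢v : a ≡ᵇ v ≡ false
        a≢v = refute (λ a=v → subst (λ x → nonEdge G x b ≡ false) (≡ᵇ⇒≡ a=v) (edge⇒adjacent G 0 a b ab)) (proj₂ centre)
        c≢v : c ≡ᵇ v ≡ false
        c≢v = refute (λ c=v → subst (λ x → nonEdge G x b ≡ false) (≡ᵇ⇒≡ c=v)
                                    (trans (isMult-sym G 0 c b) (edge⇒adjacent G 0 b c bc))) (proj₂ centre)
        end-a = ∧-true (notIn3 G u v w a) (nonEdge G u a)
                  (ind-unless≡0 (a ≡ᵇ v) (notIn3 G u v w a ∧ nonEdge G u a) (m+n≡0⇒m≡0 X X+Y≡0) a≢v)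
        end-c = ∧-true (notIn3 G u v w c) (nonEdge G w c)
                  (ind-unless≡0 (c ≡ᵇ v) (notIn3 G u v w c ∧ nonEdge G w c) (m+n≡0⇒n≡0 (X + Y) none) c≢v)

      -- Paths with a blocked first vertex, centre or last vertex number at most
      -- (Δ + 1)·Δ(Δ − 1) each: few blocked vertices, each on few paths.
      blocked-first≤ : ∑³ (λ a b c → blocked-end u a * ind (s2p G a b c)) ≤ (Δ + 1) * (Δ * (Δ ∸ 1))
      blocked-first≤ =
        subst (_≤ (Δ + 1) * (Δ * (Δ ∸ 1))) (sym (sum-cong-≗ (λ a → ∑²-*ˡ (blocked-end u a) (λ b c → ind (s2p G a b c)))))
              (weighted-sum≤ (blocked-end u) starts-at (blocked-end-count u uv) starts-at≤Δ)

      blocked-centre≤ : ∑³ (λ a b c → blocked-centre b * ind (s2p G a b c)) ≤ (Δ + 1) * (Δ * (Δ ∸ 1))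
      blocked-centre≤ =
        subst (_≤ (Δ + 1) * (Δ * (Δ ∸ 1)))
              (sym (trans (∑-comm (λ a b → sum (λ c → blocked-centre b * ind (s2p G a b c))))
                          (sum-cong-≗ (λ b → ∑²-*ˡ (blocked-centre b) (λ a c → ind (s2p G a b c))))))
              (weighted-sum≤ blocked-centre (paths-at G) blocked-centre-count paths-at≤Δ)

      blocked-last≤ : ∑³ (λ a b c → blocked-end w c * ind (s2p G a b c)) ≤ (Δ + 1) * (Δ * (Δ ∸ 1))
      blocked-last≤ =
        subst (_≤ (Δ + 1) * (Δ * (Δ ∸ 1)))
              (sym (trans (∑³-reverse (λ a b c → blocked-end w c * ind (s2p G a b c)))
                          (sum-cong-≗ (λ c → trans (sum-cong-≗ (λ b → sum-cong-≗ (λ a →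
                                                      cong (λ x → blocked-end w c * ind x) (s2p-reverse a b c))))
                                                   (∑²-*ˡ (blocked-end w c) (λ b a → ind (s2p G c b a)))))))
              (weighted-sum≤ (blocked-end w) starts-at (blocked-end-count w (trans (isMult-sym G 1 w v) vw)) starts-at≤Δ)

      -- Each simple 2-path is counted by b(G, uvw) or has a blocked vertex.
      bEmpty≤bPath : bEmpty G ≤ bPath G u v w + 3 * ((Δ + 1) * (Δ * (Δ ∸ 1)))
      bEmpty≤bPath = begin
        bEmpty G
          ≡⟨ bEmpty-as-sum G ⟩
        ∑³ (λ a b c → ind (path a b c))
          ≤⟨ ∑³-mono (λ a b c → union-bound (path a b c) (avoids a b c) (X a + Y b + Z c) (unblocked⇒avoids a b c)) ⟩
        ∑³ (λ a b c → ind (path a b c ∧ avoids a b c) + (X a + Y b + Z c) * ind (path a b c))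
          ≡⟨ ∑³-distrib-+ (λ a b c → ind (path a b c ∧ avoids a b c)) (λ a b c → (X a + Y b + Z c) * ind (path a b c)) ⟩
        ∑³ (λ a b c → ind (path a b c ∧ avoids a b c)) + ∑³ (λ a b c → (X a + Y b + Z c) * ind (path a b c))
          ≡⟨ cong₂ _+_ (sym bPath-as-sum) (∑³-split X Y Z (λ a b c → ind (path a b c))) ⟩
        bPath G u v w + (∑³ (λ a b c → X a * ind (path a b c)) + ∑³ (λ a b c → Y b * ind (path a b c))
                         + ∑³ (λ a b c → Z c * ind (path a b c)))
          ≤⟨ +-monoʳ-≤ (bPath G u v w) (+-mono-≤ (+-mono-≤ blocked-first≤ blocked-centre≤) blocked-last≤) ⟩
        bPath G u v w + (B + B + B)
          ≡⟨ cong (bPath G u v w +_) (thrice B) ⟩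
        bPath G u v w + 3 * B ∎
        where
        open ≤-Reasoning
        path = s2p G
        X = blocked-end u
        Y = blocked-centre
        Z = blocked-end w
        B = (Δ + 1) * (Δ * (Δ ∸ 1))
        thrice : ∀ x → x + x + x ≡ 3 * x
        thrice = solve-∀

  F4 : ℕ → Set
  F4 n = Fin n → Fin n → Fin n → Fin n → ℕ

  ∑⁴ : ∀ {n} → F4 n → ℕ
  ∑⁴ F = ∑² (λ a b → ∑² (λ c d → F a b c d))

  ∑⁴-mono : ∀ {n} {F H : F4 n} → (∀ a b c d → F a b c d ≤ H a b c d) → ∑⁴ F ≤ ∑⁴ H
  ∑⁴-mono F≤H = ∑²-mono (λ a b → ∑²-mono (F≤H a b))

  ∑⁴-distrib-+ : ∀ {n} (F H : F4 n) → ∑⁴ (λ a b c d → F a b c d + H a b c d) ≡ ∑⁴ F + ∑⁴ H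
  ∑⁴-distrib-+ F H = trans (sum-cong-≗ (λ a → sum-cong-≗ (λ b → ∑²-distrib-+ (F a b) (H a b))))
                           (∑²-distrib-+ (λ a b → ∑² (F a b)) (λ a b → ∑² (H a b)))

  ∑⁴-*ˡ : ∀ {n} (x : ℕ) (F : F4 n) → ∑⁴ (λ a b c d → x * F a b c d) ≡ x * ∑⁴ F
  ∑⁴-*ˡ x F = trans (sum-cong-≗ (λ a → sum-cong-≗ (λ b → ∑²-*ˡ x (F a b)))) (∑²-*ˡ x (λ a b → ∑² (F a b)))

  ∑²-zero : ∀ {n} {F : Fin n → Fin n → ℕ} → (∀ a b → F a b ≡ 0) → ∑² F ≡ 0
  ∑²-zero {F = F} F≡0 = sum-zero {f = λ a → sum (F a)} (λ a → sum-zero (F≡0 a))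

  ∑⁴-zero : ∀ {n} → ∑⁴ {n} (λ _ _ _ _ → 0) ≡ 0
  ∑⁴-zero {n} = ∑²-zero {n} {F = λ a b → ∑² {n} (λ c d → 0)} (λ a b → ∑²-zero {n} (λ c d → refl))

  ∑⁴-product : ∀ {n} (f g : Fin n → Fin n → ℕ) → ∑⁴ (λ a b c d → f a b * g c d) ≡ ∑² f * ∑² g
  ∑⁴-product f g = trans (sum-cong-≗ (λ a → sum-cong-≗ (λ b → ∑²-*ˡ (f a b) g))) (∑²-*ʳ (∑² g) f)

  ∑⁶-regroup : ∀ {n} (F : Fin n → Fin n → Fin n → Fin n → Fin n → Fin n → ℕ) →
    ∑³ (λ x₁ x₂ x₃ → ∑³ (λ x₄ x₅ x₆ → F x₁ x₂ x₃ x₄ x₅ x₆)) ≡ ∑² (λ x₂ x₅ → ∑⁴ (λ x₁ x₄ x₃ x₆ → F x₁ x₂ x₃ x₄ x₅ x₆))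
  ∑⁶-regroup {n} F =
    trans (∑-comm (λ x₁ x₂ → sum (λ x₃ → ∑³ (λ x₄ x₅ x₆ → F x₁ x₂ x₃ x₄ x₅ x₆))))
    (sum-cong-≗ (λ x₂ →
      trans (sum-cong-≗ (λ x₁ → sum-cong-≗ (λ x₃ → ∑-comm (λ x₄ x₅ → sum (F x₁ x₂ x₃ x₄ x₅)))))
      (trans (sum-cong-≗ (λ x₁ → ∑-comm (λ x₃ x₅ → ∑² (λ x₄ x₆ → F x₁ x₂ x₃ x₄ x₅ x₆))))
      (trans (∑-comm (λ x₁ x₅ → ∑² (λ x₃ x₄ → sum (F x₁ x₂ x₃ x₄ x₅))))
             (sum-cong-≗ (λ x₅ → sum-cong-≗ (λ x₁ → ∑-comm (λ x₃ x₄ → sum (F x₁ x₂ x₃ x₄ x₅)))))))))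

  total : ∀ {n} → List (F4 n) → F4 n
  total []       a b c d = 0
  total (g ∷ gs) a b c d = g a b c d + total gs a b c d

  total-bound : ∀ {n} (P : F4 n) (gs : List (F4 n)) {K : ℕ} →
    All (λ g → ∑⁴ (λ a b c d → g a b c d * P a b c d) ≤ K) gs →
    ∑⁴ (λ a b c d → total gs a b c d * P a b c d) ≤ length gs * K
  total-bound {n} P [] [] = ≤-reflexive (∑⁴-zero {n})
  total-bound P (g ∷ gs) {K} (g≤K ∷ gs≤K) = begin
    ∑⁴ (λ a b c d → (g a b c d + total gs a b c d) * P a b c d)
      ≡⟨ trans (sum-cong-≗ (λ a → sum-cong-≗ (λ b → sum-cong-≗ (λ c → sum-cong-≗ (λ d →
                 *-distribʳ-+ (P a b c d) (g a b c d) (total gs a b c d))))))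
               (∑⁴-distrib-+ (λ a b c d → g a b c d * P a b c d) (λ a b c d → total gs a b c d * P a b c d)) ⟩
    ∑⁴ (λ a b c d → g a b c d * P a b c d) + ∑⁴ (λ a b c d → total gs a b c d * P a b c d)
      ≤⟨ +-mono-≤ g≤K (total-bound P gs gs≤K) ⟩
    K + length gs * K ∎
    where open ≤-Reasoning

  total≡0 : ∀ {n} (gs : List (F4 n)) a b c d → total gs a b c d ≡ 0 → All (λ g → g a b c d ≡ 0) gs
  total≡0 []       a b c d _ = []
  total≡0 (g ∷ gs) a b c d none =
    m+n≡0⇒m≡0 (g a b c d) none ∷ total≡0 gs a b c d (m+n≡0⇒n≡0 (g a b c d) none)

  module _ {n : ℕ} (G : MultiGraph n) where

    S : Fin n → Fin n → ℕ
    S a b = ind (single G a b)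

    D : Fin n → Fin n → ℕ
    D p q = ind (double G p q)

    SS : ℕ
    SS = sum (sdeg G)

    P : F4 n
    P a b c d = S a b * S c d

    adjacent : Fin n → Fin n → ℕ
    adjacent x y = ind (not (nonEdge G x y))

    same : Fin n → Fin n → ℕ
    same x y = ind (x ≡ᵇ y)

    same≤1 : ∀ p → sum (same p) ≤ 1
    same≤1 p = ≤-reflexive (trans (sum-cong-≗ (λ x → cong ind (≡ᵇ-sym p x))) (count-eq p))

    same≤1′ : ∀ p → sum (λ x → same x p) ≤ 1
    same≤1′ p = ≤-reflexive (count-eq p)

    -- The d-switching condition for (x₁,…,x₆) = (a, p, c, b, q, d) ...
    switching : Fin n → Fin n → Fin n → Fin n → Fin n → Fin n → Bool
    switching p q a b c d =
      allDistinct6 G a p c b q d ∧ double G p q ∧ single G a b ∧ single G c d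
      ∧ nonEdge G a p ∧ nonEdge G p c ∧ nonEdge G b q ∧ nonEdge G q d

    candidate : Fin n → Fin n → Fin n → Fin n → Fin n → Fin n → Bool
    candidate p q a b c d = double G p q ∧ single G a b ∧ single G c d

    ind-candidate : ∀ p q a b c d → ind (candidate p q a b c d) ≡ D p q * P a b c d
    ind-candidate p q a b c d = trans (ind-∧ (double G p q) (single G a b ∧ single G c d))
                                      (cong (D p q *_) (ind-∧ (single G a b) (single G c d)))

    switching≤candidate : ∀ p q a b c d → ind (switching p q a b c d) ≤ ind (candidate p q a b c d)
    switching≤candidate p q a b c d =
      drop (allDistinct6 G a p c b q d) (double G p q) (single G a b) (single G c d)
           (nonEdge G a p ∧ nonEdge G p c ∧ nonEdge G b q ∧ nonEdge G q d)
      where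
      drop : ∀ x t s₁ s₂ r → ind (x ∧ t ∧ s₁ ∧ s₂ ∧ r) ≤ ind (t ∧ s₁ ∧ s₂)
      drop false t     s₁    s₂    r = z≤n
      drop true  false s₁    s₂    r = z≤n
      drop true  true  false s₂    r = z≤n
      drop true  true  true  false r = z≤n
      drop true  true  true  true  r = ind≤1 r

    fd-as-sum : fd G ≡ ∑² (λ p q → ∑⁴ (λ a b c d → ind (switching p q a b c d)))
    fd-as-sum = begin
      fd G
        ≡⟨ sumF³≡∑³ (λ x₁ x₂ x₃ → sumF (λ x₄ → sumF (λ x₅ → sumF (λ x₆ → ind (switching x₂ x₅ x₁ x₄ x₃ x₆))))) ⟩
      ∑³ (λ x₁ x₂ x₃ → sumF (λ x₄ → sumF (λ x₅ → sumF (λ x₆ → ind (switching x₂ x₅ x₁ x₄ x₃ x₆)))))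
        ≡⟨ sum-cong-≗ (λ x₁ → sum-cong-≗ (λ x₂ → sum-cong-≗ (λ x₃ →
             sumF³≡∑³ (λ x₄ x₅ x₆ → ind (switching x₂ x₅ x₁ x₄ x₃ x₆))))) ⟩
      ∑³ (λ x₁ x₂ x₃ → ∑³ (λ x₄ x₅ x₆ → ind (switching x₂ x₅ x₁ x₄ x₃ x₆)))
        ≡⟨ ∑⁶-regroup (λ x₁ x₂ x₃ x₄ x₅ x₆ → ind (switching x₂ x₅ x₁ x₄ x₃ x₆)) ⟩
      ∑² (λ p q → ∑⁴ (λ a b c d → ind (switching p q a b c d))) ∎
      where open ≡-Reasoning

    -- The candidate configurations number 2m₂·SS², with 2m₂ = Σᵥ ddeg v.
    candidates≡ : ∑² (λ p q → ∑⁴ (λ a b c d → ind (candidate p q a b c d))) ≡ sum (ddeg G) * (SS * SS)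
    candidates≡ = begin
      ∑² (λ p q → ∑⁴ (λ a b c d → ind (candidate p q a b c d)))
        ≡⟨ sum-cong-≗ (λ p → sum-cong-≗ (λ q →
             trans (sum-cong-≗ (λ a → sum-cong-≗ (λ b → sum-cong-≗ (λ c → sum-cong-≗ (λ d → ind-candidate p q a b c d)))))
                   (∑⁴-*ˡ (D p q) P))) ⟩
      ∑² (λ p q → D p q * ∑⁴ P)
        ≡⟨ ∑²-*ʳ (∑⁴ P) D ⟩
      sum (ddeg G) * ∑⁴ P
        ≡⟨ cong (sum (ddeg G) *_) (∑⁴-product S S) ⟩
      sum (ddeg G) * (SS * SS) ∎
      where open ≡-Reasoning

    fd≤candidates : fd G ≤ sum (ddeg G) * (SS * SS)
    fd≤candidates = begin
      fd G                                                        ≡⟨ fd-as-sum ⟩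
      ∑² (λ p q → ∑⁴ (λ a b c d → ind (switching p q a b c d)))   ≤⟨ ∑²-mono (λ p q → ∑⁴-mono (switching≤candidate p q)) ⟩
      ∑² (λ p q → ∑⁴ (λ a b c d → ind (candidate p q a b c d)))   ≡⟨ candidates≡ ⟩
      sum (ddeg G) * (SS * SS)                                    ∎
      where open ≤-Reasoning

    -- For the switching of the double edge pq with single edges ab and cd (as the
    -- definition of f_d orders them: x₁…x₆ = a p c b q d), the new pairs ap, pc, bq, qd must
    -- be non-edges ...
    adjacency-failures : Fin n → Fin n → List (F4 n)
    adjacency-failures p q =
      (λ a b c d → adjacent a p) ∷ (λ a b c d → adjacent p c) ∷
      (λ a b c d → adjacent b q) ∷ (λ a b c d → adjacent q d) ∷ []

    -- ... and the six vertices distinct; the coincidences not excluded otherwise are these.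
    coincidences : Fin n → Fin n → List (F4 n)
    coincidences p q =
      (λ a b c d → same a p) ∷ (λ a b c d → same p c) ∷ (λ a b c d → same b q) ∷ (λ a b c d → same q d) ∷
      (λ a b c d → same a c) ∷ (λ a b c d → same a d) ∷ (λ a b c d → same c b) ∷ (λ a b c d → same b d) ∷ []

    failures : Fin n → Fin n → F4 n
    failures p q a b c d = total (adjacency-failures p q) a b c d + total (coincidences p q) a b c d

    no-failure⇒switching : ∀ p q a b c d → candidate p q a b c d ≡ true → failures p q a b c d ≡ 0 →
                           switching p q a b c d ≡ true
    no-failure⇒switching p q a b c d cand none
      with total≡0 (adjacency-failures p q) a b c d (m+n≡0⇒m≡0 (total (adjacency-failures p q) a b c d) none)
         | total≡0 (coincidences p q) a b c d (m+n≡0⇒n≡0 (total (adjacency-failures p q) a b c d) none)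
    ... | ap ∷ pc ∷ bq ∷ qd ∷ [] | a=p ∷ p=c ∷ b=q ∷ q=d ∷ a=c ∷ a=d ∷ c=b ∷ b=d ∷ [] =
      assemble (ind≡0 _ a=p) (ind≡0 _ a=c) (edge⇒distinct G 0 a b ab) a≢q (ind≡0 _ a=d)
               (ind≡0 _ p=c) p≢b (edge⇒distinct G 1 p q pq) p≢d
               (ind≡0 _ c=b) c≢q (edge⇒distinct G 0 c d cd)
               (ind≡0 _ b=q) (ind≡0 _ b=d) (ind≡0 _ q=d)
               pq ab cd non-ap non-pc non-bq non-qd
      where
      pq = proj₁ (∧-true (double G p q) (single G a b ∧ single G c d) cand)
      ab = proj₁ (∧-true (single G a b) (single G c d) (proj₂ (∧-true (double G p q) (single G a b ∧ single G c d) cand)))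
      cd = proj₂ (∧-true (single G a b) (single G c d) (proj₂ (∧-true (double G p q) (single G a b ∧ single G c d) cand)))
      non-ap = ind-not≡0 (nonEdge G a p) ap
      non-pc = ind-not≡0 (nonEdge G p c) pc
      non-bq = ind-not≡0 (nonEdge G b q) bq
      non-qd = ind-not≡0 (nonEdge G q d) qd
      -- the double edge pq is not a non-edge, which excludes four more coincidences
      pq-adjacent : nonEdge G p q ≡ false
      pq-adjacent = edge⇒adjacent G 1 p q pq
      qp-adjacent : nonEdge G q p ≡ false
      qp-adjacent = trans (isMult-sym G 0 q p) pq-adjacent
      a≢q = refute (λ a=q → subst (λ x → nonEdge G x p ≡ false) (sym (≡ᵇ⇒≡ a=q)) qp-adjacent) non-ap
      p≢b = refute (λ p=b → subst (λ x → nonEdge G x q ≡ false) (≡ᵇ⇒≡ p=b) pq-adjacent) non-bq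
      p≢d = refute (λ p=d → subst (λ x → nonEdge G q x ≡ false) (≡ᵇ⇒≡ p=d) qp-adjacent) non-qd
      c≢q = refute (λ c=q → subst (λ x → nonEdge G p x ≡ false) (sym (≡ᵇ⇒≡ c=q)) pq-adjacent) non-pc
      assemble : ∀ {e₁ e₂ e₃ e₄ e₅ e₆ e₇ e₈ e₉ e₁₀ e₁₁ e₁₂ e₁₃ e₁₄ e₁₅ t₁ t₂ t₃ t₄ t₅ t₆ t₇} →
        e₁ ≡ false → e₂ ≡ false → e₃ ≡ false → e₄ ≡ false → e₅ ≡ false → e₆ ≡ false → e₇ ≡ false →
        e₈ ≡ false → e₉ ≡ false → e₁₀ ≡ false → e₁₁ ≡ false → e₁₂ ≡ false → e₁₃ ≡ false → e₁₄ ≡ false →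
        e₁₅ ≡ false → t₁ ≡ true → t₂ ≡ true → t₃ ≡ true → t₄ ≡ true → t₅ ≡ true → t₆ ≡ true → t₇ ≡ true →
        (not e₁ ∧ not e₂ ∧ not e₃ ∧ not e₄ ∧ not e₅ ∧ not e₆ ∧ not e₇ ∧ not e₈ ∧ not e₉ ∧ not e₁₀
          ∧ not e₁₁ ∧ not e₁₂ ∧ not e₁₃ ∧ not e₁₄ ∧ not e₁₅) ∧ t₁ ∧ t₂ ∧ t₃ ∧ t₄ ∧ t₅ ∧ t₆ ∧ t₇ ≡ true
      assemble refl refl refl refl refl refl refl refl refl refl refl refl refl refl refl
               refl refl refl refl refl refl refl = refl

    candidate≤switching+failures : ∀ p q a b c d →
      ind (candidate p q a b c d) ≤ ind (switching p q a b c d) + D p q * (failures p q a b c d * P a b c d)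
    candidate≤switching+failures p q a b c d = begin
      ind cand
        ≤⟨ union-bound cand (switching p q a b c d) F (no-failure⇒switching p q a b c d) ⟩
      ind (cand ∧ switching p q a b c d) + F * ind cand
        ≤⟨ +-monoˡ-≤ (F * ind cand) (ind-∧-≤ʳ cand (switching p q a b c d)) ⟩
      ind (switching p q a b c d) + F * ind cand
        ≡⟨ cong (λ x → ind (switching p q a b c d) + F * x) (ind-candidate p q a b c d) ⟩
      ind (switching p q a b c d) + F * (D p q * P a b c d)
        ≡⟨ cong (ind (switching p q a b c d) +_) (swap F (D p q) (P a b c d)) ⟩
      ind (switching p q a b c d) + D p q * (F * P a b c d) ∎
      where
      open ≤-Reasoning
      cand = candidate p q a b c d
      F = failures p q a b c d
      swap : ∀ x y z → x * (y * z) ≡ y * (x * z)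
      swap = solve-∀

    module _ {Δ : ℕ} (deg≤Δ : ∀ v → deg G v ≤ Δ) where

      weight-first : ∀ (h : Fin n → ℕ) {c} → sum h ≤ c → ∑² (λ a b → h a * S a b) ≤ c * Δ
      weight-first h {c} Σh≤c = begin
        ∑² (λ a b → h a * S a b)   ≡⟨ sum-cong-≗ (λ a → *-distribˡ-sum (h a) (S a)) ⟨
        sum (λ a → h a * sdeg G a) ≤⟨ weighted-sum≤ h (sdeg G) Σh≤c (sdeg≤Δ G deg≤Δ) ⟩
        c * Δ                      ∎
        where open ≤-Reasoning

      weight-second : ∀ (h : Fin n → ℕ) {c} → sum h ≤ c → ∑² (λ a b → h b * S a b) ≤ c * Δ
      weight-second h Σh≤c =
        subst (_≤ _) (sym (trans (∑-comm (λ a b → h b * S a b))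
                                 (sum-cong-≗ (λ b → sum-cong-≗ (λ a → cong (λ x → h b * ind x) (isMult-sym G 1 a b))))))
              (weight-first h Σh≤c)

      first-pair-bound : ∀ (f : Fin n → Fin n → ℕ) {K} → ∑² (λ a b → f a b * S a b) ≤ K →
                         ∑⁴ (λ a b c d → f a b * P a b c d) ≤ SS * K
      first-pair-bound f {K} ΣfS≤K = begin
        ∑⁴ (λ a b c d → f a b * (S a b * S c d))
          ≡⟨ sum-cong-≗ (λ a → sum-cong-≗ (λ b → sum-cong-≗ (λ c → sum-cong-≗ (λ d → *-assoc (f a b) (S a b) (S c d))))) ⟨
        ∑⁴ (λ a b c d → f a b * S a b * S c d)
          ≡⟨ ∑⁴-product (λ a b → f a b * S a b) S ⟩
        ∑² (λ a b → f a b * S a b) * SS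
          ≤⟨ *-monoˡ-≤ SS ΣfS≤K ⟩
        K * SS
          ≡⟨ *-comm K SS ⟩
        SS * K ∎
        where open ≤-Reasoning

      second-pair-bound : ∀ (f : F4 n) {K} → (∀ a b → ∑² (λ c d → f a b c d * S c d) ≤ K) →
                          ∑⁴ (λ a b c d → f a b c d * P a b c d) ≤ SS * K
      second-pair-bound f {K} ΣfS≤K = begin
        ∑⁴ (λ a b c d → f a b c d * (S a b * S c d))
          ≡⟨ sum-cong-≗ (λ a → sum-cong-≗ (λ b → sum-cong-≗ (λ c → sum-cong-≗ (λ d → swap (f a b c d) (S a b) (S c d))))) ⟩
        ∑⁴ (λ a b c d → S a b * (f a b c d * S c d))
          ≡⟨ sum-cong-≗ (λ a → sum-cong-≗ (λ b → ∑²-*ˡ (S a b) (λ c d → f a b c d * S c d))) ⟩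
        ∑² (λ a b → S a b * ∑² (λ c d → f a b c d * S c d))
          ≤⟨ ∑²-mono (λ a b → *-monoʳ-≤ (S a b) (ΣfS≤K a b)) ⟩
        ∑² (λ a b → S a b * K)
          ≡⟨ ∑²-*ʳ K S ⟩
        SS * K ∎
        where
        open ≤-Reasoning
        swap : ∀ x y z → x * (y * z) ≡ y * (x * z)
        swap = solve-∀

      neighbours≤Δ : ∀ p → sum (adjacent p) ≤ Δ
      neighbours≤Δ p = ≤-trans (neighbours≤deg G p) (deg≤Δ p)

      neighbours≤Δ′ : ∀ p → sum (λ x → adjacent x p) ≤ Δ
      neighbours≤Δ′ p = subst (_≤ Δ) (sum-cong-≗ (λ x → cong (ind ∘ not) (isMult-sym G 0 p x))) (neighbours≤Δ p)

      adjacency-bounds : ∀ p q → All (λ g → ∑⁴ (λ a b c d → g a b c d * P a b c d) ≤ SS * (Δ * Δ)) (adjacency-failures p q)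
      adjacency-bounds p q =
        first-pair-bound  (λ a b → adjacent a p) (weight-first (λ a → adjacent a p) (neighbours≤Δ′ p)) ∷
        second-pair-bound (λ a b c d → adjacent p c) (λ _ _ → weight-first (adjacent p) (neighbours≤Δ p)) ∷
        first-pair-bound  (λ a b → adjacent b q) (weight-second (λ b → adjacent b q) (neighbours≤Δ′ q)) ∷
        second-pair-bound (λ a b c d → adjacent q d) (λ _ _ → weight-second (adjacent q) (neighbours≤Δ q)) ∷ []

      coincidence-bounds : ∀ p q → All (λ g → ∑⁴ (λ a b c d → g a b c d * P a b c d) ≤ SS * (1 * Δ)) (coincidences p q)
      coincidence-bounds p q =
        first-pair-bound  (λ a b → same a p) (weight-first (λ a → same a p) (same≤1′ p)) ∷
        second-pair-bound (λ a b c d → same p c) (λ _ _ → weight-first (same p) (same≤1 p)) ∷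
        first-pair-bound  (λ a b → same b q) (weight-second (λ b → same b q) (same≤1′ q)) ∷
        second-pair-bound (λ a b c d → same q d) (λ _ _ → weight-second (same q) (same≤1 q)) ∷
        second-pair-bound (λ a b c d → same a c) (λ a _ → weight-first (same a) (same≤1 a)) ∷
        second-pair-bound (λ a b c d → same a d) (λ a _ → weight-second (same a) (same≤1 a)) ∷
        second-pair-bound (λ a b c d → same c b) (λ _ b → weight-first (λ c → same c b) (same≤1′ b)) ∷
        second-pair-bound (λ a b c d → same b d) (λ _ b → weight-second (same b) (same≤1 b)) ∷ []

      failures-bound : ∀ p q → ∑⁴ (λ a b c d → failures p q a b c d * P a b c d) ≤ SS * (4 * (Δ * Δ) + 8 * Δ)
      failures-bound p q = begin
        ∑⁴ (λ a b c d → failures p q a b c d * P a b c d)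
          ≡⟨ sum-cong-≗ (λ a → sum-cong-≗ (λ b → sum-cong-≗ (λ c → sum-cong-≗ (λ d →
               *-distribʳ-+ (P a b c d) (total (adjacency-failures p q) a b c d) (total (coincidences p q) a b c d))))) ⟩
        ∑⁴ (λ a b c d → total (adjacency-failures p q) a b c d * P a b c d + total (coincidences p q) a b c d * P a b c d)
          ≡⟨ ∑⁴-distrib-+ (λ a b c d → total (adjacency-failures p q) a b c d * P a b c d)
                          (λ a b c d → total (coincidences p q) a b c d * P a b c d) ⟩
        ∑⁴ (λ a b c d → total (adjacency-failures p q) a b c d * P a b c d)
          + ∑⁴ (λ a b c d → total (coincidences p q) a b c d * P a b c d)
          ≤⟨ +-mono-≤ (total-bound P (adjacency-failures p q) (adjacency-bounds p q))
                      (total-bound P (coincidences p q) (coincidence-bounds p q)) ⟩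
        4 * (SS * (Δ * Δ)) + 8 * (SS * (1 * Δ))
          ≡⟨ collect SS Δ ⟩
        SS * (4 * (Δ * Δ) + 8 * Δ) ∎
        where
        open ≤-Reasoning
        collect : ∀ s x → 4 * (s * (x * x)) + 8 * (s * (1 * x)) ≡ s * (4 * (x * x) + 8 * x)
        collect = solve-∀

      candidates≤fd : sum (ddeg G) * (SS * SS) ≤ fd G + sum (ddeg G) * (SS * (4 * (Δ * Δ) + 8 * Δ))
      candidates≤fd = begin
        sum (ddeg G) * (SS * SS)
          ≡⟨ candidates≡ ⟨
        ∑² (λ p q → ∑⁴ (λ a b c d → ind (candidate p q a b c d)))
          ≤⟨ ∑²-mono (λ p q → ∑⁴-mono (candidate≤switching+failures p q)) ⟩
        ∑² (λ p q → ∑⁴ (λ a b c d → ind (switching p q a b c d) + D p q * (failures p q a b c d * P a b c d)))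
          ≡⟨ trans (sum-cong-≗ (λ p → sum-cong-≗ (λ q → ∑⁴-distrib-+ (λ a b c d → ind (switching p q a b c d))
                                                                      (λ a b c d → D p q * (failures p q a b c d * P a b c d)))))
                   (∑²-distrib-+ (λ p q → ∑⁴ (λ a b c d → ind (switching p q a b c d)))
                                 (λ p q → ∑⁴ (λ a b c d → D p q * (failures p q a b c d * P a b c d)))) ⟩
        ∑² (λ p q → ∑⁴ (λ a b c d → ind (switching p q a b c d)))
          + ∑² (λ p q → ∑⁴ (λ a b c d → D p q * (failures p q a b c d * P a b c d)))
          ≡⟨ cong₂ _+_ (sym fd-as-sum) (sum-cong-≗ (λ p → sum-cong-≗ (λ q → ∑⁴-*ˡ (D p q) (λ a b c d → failures p q a b c d * P a b c d)))) ⟩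
        fd G + ∑² (λ p q → D p q * ∑⁴ (λ a b c d → failures p q a b c d * P a b c d))
          ≤⟨ +-monoʳ-≤ (fd G) (∑²-mono (λ p q → *-monoʳ-≤ (D p q) (failures-bound p q))) ⟩
        fd G + ∑² (λ p q → D p q * (SS * (4 * (Δ * Δ) + 8 * Δ)))
          ≡⟨ cong (fd G +_) (∑²-*ʳ (SS * (4 * (Δ * Δ) + 8 * Δ)) D) ⟩
        fd G + sum (ddeg G) * (SS * (4 * (Δ * Δ) + 8 * Δ)) ∎
        where open ≤-Reasoning

  cube-bound : ∀ Δ → (Δ + 1) * (Δ * (Δ ∸ 1)) ≤ Δ * Δ * Δ
  cube-bound zero    = z≤n
  cube-bound (suc k) = begin
    (suc k + 1) * (suc k * k)           ≡⟨ expand k ⟩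
    k * k * k + 3 * k * k + 2 * k       ≤⟨ m≤m+n _ (k + 1) ⟩
    k * k * k + 3 * k * k + 2 * k + (k + 1) ≡⟨ cube k ⟩
    suc k * suc k * suc k               ∎
    where
    open ≤-Reasoning
    expand : ∀ k → (suc k + 1) * (suc k * k) ≡ k * k * k + 3 * k * k + 2 * k
    expand = solve-∀
    cube : ∀ k → k * k * k + 3 * k * k + 2 * k + (k + 1) ≡ suc k * suc k * suc k
    cube = solve-∀

  failure-budget : ∀ Δ → 8 * ((Δ ∸ 1) * (Δ ∸ 1)) + (4 * (Δ * Δ) + 8 * Δ) + 4 * Δ ≤ 12 * Δ * Δ + 8
  failure-budget zero    = z≤n
  failure-budget (suc k) = begin
    8 * (k * k) + (4 * (suc k * suc k) + 8 * suc k) + 4 * suc k ≡⟨ expand k ⟩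
    12 * k * k + 20 * k + 16                                     ≤⟨ m≤m+n _ (4 * k + 4) ⟩
    12 * k * k + 20 * k + 16 + (4 * k + 4)                       ≡⟨ target k ⟩
    12 * suc k * suc k + 8                                       ∎
    where
    open ≤-Reasoning
    expand : ∀ k → 8 * (k * k) + (4 * (suc k * suc k) + 8 * suc k) + 4 * suc k ≡ 12 * k * k + 20 * k + 16
    expand = solve-∀
    target : ∀ k → 12 * k * k + 20 * k + 16 + (4 * k + 4) ≡ 12 * suc k * suc k + 8
    target = solve-∀

  product-gap : ∀ s e c x → e + c + x ≤ s → (s + e) * x + s * c ≤ s * s
  product-gap s e c x ecx≤s = subst (λ s → (s + e) * x + s * c ≤ s * s) (m+[n∸m]≡n ecx≤s) (gap e c x (s ∸ (e + c + x)))
    where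
    gap : ∀ e c x r → (e + c + x + r + e) * x + (e + c + x + r) * c ≤ (e + c + x + r) * (e + c + x + r)
    gap e c x r = ≤-trans (m≤m+n _ (x * r + (r + e) * (r + e) + c * (r + e))) (≤-reflexive (square e c x r))
      where
      square : ∀ e c x r → (e + c + x + r + e) * x + (e + c + x + r) * c + (x * r + (r + e) * (r + e) + c * (r + e))
                           ≡ (e + c + x + r) * (e + c + x + r)
      square = solve-∀

  cancel-square : ∀ a b M → M ≢ 0 → a * (M * M) ≤ b * (M * M) → a ≤ b
  cancel-square a b M M≢0 = *-cancelʳ-≤ a b (M * M) {{m*n≢0 M M {{ℕ.≢-nonZero M≢0}} {{ℕ.≢-nonZero M≢0}}}}

  module Estimates {n : ℕ} (G : MultiGraph n) (mult≤2 : ∀ i j → mult G i j ≤ 2)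
                   {Δ : ℕ} (deg≤Δ : ∀ v → deg G v ≤ Δ) where

    M : ℕ
    M = sum (deg G)

    m : ℕ
    m = numDouble G

    -- each double edge contributes 4 to the degree sum
    M≡SS+4m : M ≡ SS G + 4 * m
    M≡SS+4m = begin
      sum (deg G)                          ≡⟨ sum-cong-≗ (deg-split G mult≤2) ⟩
      sum (λ v → sdeg G v + 2 * ddeg G v)  ≡⟨ ∑-distrib-+ (sdeg G) (λ v → 2 * ddeg G v) ⟩
      SS G + sum (λ v → 2 * ddeg G v)      ≡⟨ cong (SS G +_) (*-distribˡ-sum 2 (ddeg G)) ⟨
      SS G + 2 * sum (ddeg G)              ≡⟨ cong (λ x → SS G + 2 * x) (sum-ddeg G) ⟩
      SS G + 2 * (2 * m)                   ≡⟨ cong (SS G +_) (*-assoc 2 2 m) ⟨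
      SS G + 4 * m                         ∎
      where open ≡-Reasoning

    M₂≤ : M₂ G ≤ (Δ ∸ 1) * M
    M₂≤ = begin
      sum (λ v → deg G v * (deg G v ∸ 1)) ≤⟨ sum-mono (λ v → *-monoʳ-≤ (deg G v) (∸-monoˡ-≤ 1 (deg≤Δ v))) ⟩
      sum (λ v → deg G v * (Δ ∸ 1))       ≡⟨ *-distribʳ-sum (Δ ∸ 1) (deg G) ⟨
      M * (Δ ∸ 1)                         ≡⟨ *-comm M (Δ ∸ 1) ⟩
      (Δ ∸ 1) * M                         ∎
      where open ≤-Reasoning

    bEmpty-bounds : (M₂ G ≤ bEmpty G + 8 * m * Δ) × (bEmpty G ≤ M₂ G)
    bEmpty-bounds = ≤-trans (m≤m+n (M₂ G) (12 * m)) (bEmpty-lower G mult≤2 deg≤Δ) , bEmpty≤M₂ G mult≤2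

    bPath-bounds : ∀ u v w → IsSimple2Path G u v w →
                   (M₂ G + 12 * m ≤ bPath G u v w + (3 * (Δ * Δ * Δ) + 8 * m * Δ)) × (bPath G u v w ≤ M₂ G)
    bPath-bounds u v w path = lower , ≤-trans (bPath≤bEmpty G deg≤Δ u v w uv vw) (bEmpty≤M₂ G mult≤2)
      where
      open ≤-Reasoning
      uv = proj₁ (s2p-edges G u v w path)
      vw = proj₂ (s2p-edges G u v w path)
      lower = begin
        M₂ G + 12 * m
          ≤⟨ bEmpty-lower G mult≤2 deg≤Δ ⟩
        bEmpty G + 8 * m * Δ
          ≤⟨ +-monoˡ-≤ (8 * m * Δ) (bEmpty≤bPath G deg≤Δ u v w uv vw) ⟩
        bPath G u v w + 3 * ((Δ + 1) * (Δ * (Δ ∸ 1))) + 8 * m * Δ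
          ≤⟨ +-monoˡ-≤ (8 * m * Δ) (+-monoʳ-≤ (bPath G u v w) (*-monoʳ-≤ 3 (cube-bound Δ))) ⟩
        bPath G u v w + 3 * (Δ * Δ * Δ) + 8 * m * Δ
          ≡⟨ +-assoc (bPath G u v w) (3 * (Δ * Δ * Δ)) (8 * m * Δ) ⟩
        bPath G u v w + (3 * (Δ * Δ * Δ) + 8 * m * Δ) ∎

    fd-upper : fd G ≤ 2 * m * (M * M)
    fd-upper = begin
      fd G                          ≤⟨ fd≤candidates G ⟩
      sum (ddeg G) * (SS G * SS G)  ≤⟨ *-monoʳ-≤ (sum (ddeg G)) (*-mono-≤ SS≤M SS≤M) ⟩
      sum (ddeg G) * (M * M)        ≡⟨ cong (_* (M * M)) (sum-ddeg G) ⟩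
      2 * m * (M * M)               ∎
      where
      open ≤-Reasoning
      SS≤M : SS G ≤ M
      SS≤M = subst (SS G ≤_) (sym M≡SS+4m) (m≤m+n (SS G) (4 * m))

    -- The hypothesis m M² ≤ M₂² forces m ≤ (Δ − 1)², as M₂ ≤ (Δ − 1) M.
    few-doubles : M ≢ 0 → m * (M * M) ≤ M₂ G * M₂ G → m ≤ (Δ ∸ 1) * (Δ ∸ 1)
    few-doubles M≢0 hyp = cancel-square m ((Δ ∸ 1) * (Δ ∸ 1)) M M≢0 (begin
      m * (M * M)                       ≤⟨ hyp ⟩
      M₂ G * M₂ G                       ≤⟨ *-mono-≤ M₂≤ M₂≤ ⟩
      (Δ ∸ 1) * M * ((Δ ∸ 1) * M)       ≡⟨ square-product (Δ ∸ 1) M ⟩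
      (Δ ∸ 1) * (Δ ∸ 1) * (M * M)       ∎)
      where
      open ≤-Reasoning
      square-product : ∀ a b → a * b * (a * b) ≡ a * a * (b * b)
      square-product = solve-∀

    -- Then, if M + 4Δ = 12Δ² + 8 + x, the single edges leave room for the failures.
    room : m ≤ (Δ ∸ 1) * (Δ ∸ 1) → ∀ x → M + 4 * Δ ≡ 12 * Δ * Δ + 8 + x → 4 * m + (4 * (Δ * Δ) + 8 * Δ) + x ≤ SS G
    room m≤ x M+4Δ≡ = +-cancelʳ-≤ (4 * m + 4 * Δ) (4 * m + cF + x) (SS G) (begin
      4 * m + cF + x + (4 * m + 4 * Δ)  ≡⟨ regroup m cF x Δ ⟩
      8 * m + cF + 4 * Δ + x            ≤⟨ +-monoˡ-≤ x (≤-trans (+-monoˡ-≤ (4 * Δ) (+-monoˡ-≤ cF (*-monoʳ-≤ 8 m≤))) (failure-budget Δ)) ⟩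
      12 * Δ * Δ + 8 + x                ≡⟨ M+4Δ≡ ⟨
      M + 4 * Δ                         ≡⟨ cong (_+ 4 * Δ) M≡SS+4m ⟩
      SS G + 4 * m + 4 * Δ              ≡⟨ +-assoc (SS G) (4 * m) (4 * Δ) ⟩
      SS G + (4 * m + 4 * Δ)            ∎)
      where
      open ≤-Reasoning
      cF = 4 * (Δ * Δ) + 8 * Δ
      regroup : ∀ m c x Δ → 4 * m + c + x + (4 * m + 4 * Δ) ≡ 8 * m + c + 4 * Δ + x
      regroup = solve-∀

    fd-lower : m * (M * M) ≤ M₂ G * M₂ G → ∀ x → M + 4 * Δ ≡ 12 * Δ * Δ + 8 + x → 2 * m * M * x ≤ fd G
    fd-lower hyp x M+4Δ≡ with M ℕ.≟ 0
    ... | yes M≡0 = subst (λ y → 2 * m * y * x ≤ fd G) (sym M≡0) (≤-trans (≤-reflexive (cong (_* x) (*-zeroʳ (2 * m)))) z≤n)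
    ... | no M≢0 = +-cancelʳ-≤ (T * (SS G * cF)) (2 * m * M * x) (fd G) (begin
        2 * m * M * x + T * (SS G * cF)   ≡⟨ cong (_+ T * (SS G * cF)) (trans (*-assoc (2 * m) M x) (cong (_* (M * x)) (sym (sum-ddeg G)))) ⟩
        T * (M * x) + T * (SS G * cF)     ≡⟨ *-distribˡ-+ T (M * x) (SS G * cF) ⟨
        T * (M * x + SS G * cF)           ≤⟨ *-monoʳ-≤ T gap ⟩
        T * (SS G * SS G)                 ≤⟨ candidates≤fd G deg≤Δ ⟩
        fd G + T * (SS G * cF)            ∎)
      where
      open ≤-Reasoning
      T = sum (ddeg G)
      cF = 4 * (Δ * Δ) + 8 * Δ
      gap : M * x + SS G * cF ≤ SS G * SS G
      gap = subst (λ y → y * x + SS G * cF ≤ SS G * SS G) (sym M≡SS+4m)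
                  (product-gap (SS G) (4 * m) cF x (room (few-doubles M≢0 hyp) x M+4Δ≡))

  module Hypotheses {n : ℕ} (d : Fin n → ℕ) (m₂ : ℕ) (G : MultiGraph n) (G∈ : InG0 d m₂ G) where

    deg≡d : ∀ v → deg G v ≡ d v
    deg≡d v = trans (sym (degree≡deg G v)) (proj₁ G∈ v)

    deg≤Δ : ∀ v → deg G v ≤ maxDeg d
    deg≤Δ v = subst (_≤ maxDeg d) (sym (deg≡d v)) (≤maxDeg d v)

    open Estimates G (proj₁ (proj₂ G∈)) deg≤Δ

    M₂≡ : M2sum d ≡ M₂ G
    M₂≡ = trans (sumF≡sum (λ v → d v * (d v ∸ 1))) (sum-cong-≗ (λ v → cong (λ x → x * (x ∸ 1)) (sym (deg≡d v))))

    M≡ : Msum d ≡ M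
    M≡ = trans (sumF≡sum d) (sum-cong-≗ (λ v → sym (deg≡d v)))

    m₂≡ : m₂ ≡ m
    m₂≡ = sym (proj₂ (proj₂ G∈))

    bEmpty-estimate : (M2sum d ≤ bEmpty G + 8 * m₂ * maxDeg d) × (bEmpty G ≤ M2sum d)
    bEmpty-estimate rewrite M₂≡ | m₂≡ = bEmpty-bounds

    bPath-estimate : ∀ u v w → IsSimple2Path G u v w →
      (M2sum d + 12 * m₂ ≤ bPath G u v w + (3 * (maxDeg d * maxDeg d * maxDeg d) + 8 * m₂ * maxDeg d))
      × (bPath G u v w ≤ M2sum d)
    bPath-estimate rewrite M₂≡ | m₂≡ = bPath-bounds

    fd-estimate : m₂ * (Msum d * Msum d) ≤ M2sum d * M2sum d →
      (∀ x → Msum d + 4 * maxDeg d ≡ 12 * maxDeg d * maxDeg d + 8 + x → 2 * m₂ * Msum d * x ≤ fd G)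
      × (fd G ≤ 2 * m₂ * (Msum d * Msum d))
    fd-estimate rewrite M₂≡ | M≡ | m₂≡ = λ hyp → fd-lower hyp , fd-upper

module IntegerForms where

  open import Data.Nat using (ℕ; suc; _+_; _*_; _≤_; z≤n)
  open import Data.Nat.Properties using (m≤m+n; ≤-trans)
  open import Data.Integer using (ℤ; +_; -_; -[1+_]; +≤+) renaming (_+_ to _+ℤ_; _-_ to _-ℤ_; _*_ to _*ℤ_; _≤_ to _≤ℤ_)
  open import Data.Integer.Properties using (pos-+; pos-*; +-injective; +-monoˡ-≤; +-identityʳ; module ≤-Reasoning)
  open import Data.Integer.Tactic.RingSolver using (solve-∀)
  open import Relation.Binary.PropositionalEquality using (_≡_; sym; trans; cong; module ≡-Reasoning)

  pos-*³ : ∀ a b c → + (a * b * c) ≡ + a *ℤ + b *ℤ + c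
  pos-*³ a b c = trans (pos-* (a * b) c) (cong (_*ℤ + c) (pos-* a b))

  pos-*⁴ : ∀ a b c d → + (a * b * c * d) ≡ + a *ℤ + b *ℤ + c *ℤ + d
  pos-*⁴ a b c d = trans (pos-* (a * b * c) d) (cong (_*ℤ + d) (pos-*³ a b c))

  shift : ∀ (L : ℤ) (a e c : ℕ) → L +ℤ + e ≡ + a → a ≤ c + e → L ≤ℤ + c
  shift L a e c L+e≡a a≤c+e = begin
    L                    ≡⟨ add-sub L (+ e) ⟨
    (L +ℤ + e) -ℤ + e    ≡⟨ cong (_-ℤ + e) L+e≡a ⟩
    + a -ℤ + e           ≤⟨ +-monoˡ-≤ (- + e) (+≤+ a≤c+e) ⟩
    + (c + e) -ℤ + e     ≡⟨ cong (_-ℤ + e) (pos-+ c e) ⟩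
    (+ c +ℤ + e) -ℤ + e  ≡⟨ add-sub (+ c) (+ e) ⟩
    + c                  ∎
    where
    open ≤-Reasoning
    add-sub : ∀ x y → (x +ℤ y) -ℤ y ≡ x
    add-sub = solve-∀

  bEmpty-ℤ : ∀ M₂ m Δ b → M₂ ≤ b + 8 * m * Δ → + M₂ -ℤ (+ 8) *ℤ (+ m) *ℤ (+ Δ) ≤ℤ + b
  bEmpty-ℤ M₂ m Δ b = shift _ M₂ (8 * m * Δ) b (begin
      (+ M₂ -ℤ (+ 8) *ℤ (+ m) *ℤ (+ Δ)) +ℤ + (8 * m * Δ)
        ≡⟨ cong ((+ M₂ -ℤ (+ 8) *ℤ (+ m) *ℤ (+ Δ)) +ℤ_) (pos-*³ 8 m Δ) ⟩
      (+ M₂ -ℤ (+ 8) *ℤ (+ m) *ℤ (+ Δ)) +ℤ (+ 8) *ℤ (+ m) *ℤ (+ Δ)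
        ≡⟨ sub-add (+ M₂) ((+ 8) *ℤ (+ m) *ℤ (+ Δ)) ⟩
      + M₂ ∎)
    where
    open ≡-Reasoning
    sub-add : ∀ x y → (x -ℤ y) +ℤ y ≡ x
    sub-add = solve-∀

  bPath-ℤ : ∀ M₂ m Δ b → M₂ + 12 * m ≤ b + (3 * (Δ * Δ * Δ) + 8 * m * Δ) →
            + M₂ -ℤ (+ 4) *ℤ (+ m) *ℤ ((+ 2) *ℤ (+ Δ) -ℤ (+ 3)) -ℤ (+ 3) *ℤ ((+ Δ) *ℤ (+ Δ) *ℤ (+ Δ)) ≤ℤ + b
  bPath-ℤ M₂ m Δ b = shift L (M₂ + 12 * m) (3 * (Δ * Δ * Δ) + 8 * m * Δ) b (begin
      L +ℤ + (3 * (Δ * Δ * Δ) + 8 * m * Δ)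
        ≡⟨ cong (L +ℤ_) (pos-+ (3 * (Δ * Δ * Δ)) (8 * m * Δ)) ⟩
      L +ℤ (+ (3 * (Δ * Δ * Δ)) +ℤ + (8 * m * Δ))
        ≡⟨ cong (λ z → L +ℤ (z +ℤ + (8 * m * Δ))) (trans (pos-* 3 (Δ * Δ * Δ)) (cong ((+ 3) *ℤ_) (pos-*³ Δ Δ Δ))) ⟩
      L +ℤ ((+ 3) *ℤ ((+ Δ) *ℤ (+ Δ) *ℤ (+ Δ)) +ℤ + (8 * m * Δ))
        ≡⟨ cong (λ z → L +ℤ ((+ 3) *ℤ ((+ Δ) *ℤ (+ Δ) *ℤ (+ Δ)) +ℤ z)) (pos-*³ 8 m Δ) ⟩
      L +ℤ ((+ 3) *ℤ ((+ Δ) *ℤ (+ Δ) *ℤ (+ Δ)) +ℤ (+ 8) *ℤ (+ m) *ℤ (+ Δ))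
        ≡⟨ cancel (+ M₂) (+ m) (+ Δ) ⟩
      + M₂ +ℤ (+ 12) *ℤ (+ m)
        ≡⟨ cong (+ M₂ +ℤ_) (pos-* 12 m) ⟨
      + M₂ +ℤ + (12 * m)
        ≡⟨ pos-+ M₂ (12 * m) ⟨
      + (M₂ + 12 * m) ∎)
    where
    open ≡-Reasoning
    L = + M₂ -ℤ (+ 4) *ℤ (+ m) *ℤ ((+ 2) *ℤ (+ Δ) -ℤ (+ 3)) -ℤ (+ 3) *ℤ ((+ Δ) *ℤ (+ Δ) *ℤ (+ Δ))
    cancel : ∀ X m D → (X -ℤ (+ 4) *ℤ m *ℤ ((+ 2) *ℤ D -ℤ (+ 3)) -ℤ (+ 3) *ℤ (D *ℤ D *ℤ D))
                         +ℤ ((+ 3) *ℤ (D *ℤ D *ℤ D) +ℤ (+ 8) *ℤ m *ℤ D) ≡ X +ℤ (+ 12) *ℤ m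
    cancel = solve-∀

  fd-ℤ : ∀ m M Δ f → (∀ x → M + 4 * Δ ≡ 12 * Δ * Δ + 8 + x → 2 * m * M * x ≤ f) →
         (+ 2) *ℤ (+ m) *ℤ (+ M) *ℤ (+ M -ℤ ((+ 12) *ℤ (+ Δ) *ℤ (+ Δ) -ℤ (+ 4) *ℤ (+ Δ) +ℤ (+ 8))) ≤ℤ + f
  fd-ℤ m M Δ f bound with + M -ℤ ((+ 12) *ℤ (+ Δ) *ℤ (+ Δ) -ℤ (+ 4) *ℤ (+ Δ) +ℤ (+ 8)) in excess
  ... | + x = shift _ (2 * m * M * x) 0 f
        (trans (+-identityʳ _) (sym (pos-*⁴ 2 m M x)))
        (≤-trans (bound x (+-injective M+4Δ≡)) (m≤m+n f 0))
    where
    open ≡-Reasoning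
    M+4Δ≡ : + (M + 4 * Δ) ≡ + (12 * Δ * Δ + 8 + x)
    M+4Δ≡ = begin
      + (M + 4 * Δ)
        ≡⟨ trans (pos-+ M (4 * Δ)) (cong (+ M +ℤ_) (pos-* 4 Δ)) ⟩
      + M +ℤ (+ 4) *ℤ (+ Δ)
        ≡⟨ rearrange (+ M) (+ Δ) ⟩
      ((+ 12) *ℤ (+ Δ) *ℤ (+ Δ) +ℤ (+ 8)) +ℤ (+ M -ℤ ((+ 12) *ℤ (+ Δ) *ℤ (+ Δ) -ℤ (+ 4) *ℤ (+ Δ) +ℤ (+ 8)))
        ≡⟨ cong (((+ 12) *ℤ (+ Δ) *ℤ (+ Δ) +ℤ (+ 8)) +ℤ_) excess ⟩
      ((+ 12) *ℤ (+ Δ) *ℤ (+ Δ) +ℤ (+ 8)) +ℤ + x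
        ≡⟨ cong (λ z → (z +ℤ (+ 8)) +ℤ + x) (pos-*³ 12 Δ Δ) ⟨
      (+ (12 * Δ * Δ) +ℤ (+ 8)) +ℤ + x
        ≡⟨ cong (_+ℤ + x) (pos-+ (12 * Δ * Δ) 8) ⟨
      + (12 * Δ * Δ + 8) +ℤ + x
        ≡⟨ pos-+ (12 * Δ * Δ + 8) x ⟨
      + (12 * Δ * Δ + 8 + x) ∎
      where
      rearrange : ∀ M D → M +ℤ (+ 4) *ℤ D ≡ ((+ 12) *ℤ D *ℤ D +ℤ (+ 8)) +ℤ (M -ℤ ((+ 12) *ℤ D *ℤ D -ℤ (+ 4) *ℤ D +ℤ (+ 8)))
      rearrange = solve-∀
  ... | -[1+ z ] = shift _ 0 (2 * m * M * suc z) f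
        (trans (cong ((+ 2) *ℤ (+ m) *ℤ (+ M) *ℤ (- + suc z) +ℤ_) (pos-*⁴ 2 m M (suc z)))
               (opposite (+ 2) (+ m) (+ M) (+ suc z)))
        z≤n
    where
    opposite : ∀ a b c y → a *ℤ b *ℤ c *ℤ (- y) +ℤ a *ℤ b *ℤ c *ℤ y ≡ + 0
    opposite = solve-∀

open import Data.Nat using (ℕ; _≤_; _*_)
open import Data.Fin using (Fin)
open import Data.Integer using (ℤ; +_; _-_; _+_) renaming (_*_ to _*ℤ_; _≤_ to _≤ℤ_)
open import Data.Product using (_×_; _,_)
open Counting using (module Hypotheses)
open IntegerForms using (bEmpty-ℤ; bPath-ℤ; fd-ℤ)

lemma4p4 : (n : ℕ) (d : Fin n → ℕ) (m₂ : ℕ) (G : MultiGraph n) →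
    InG0 d m₂ G →
    m₂ * (Msum d * Msum d) ≤ M2sum d * M2sum d →
    ((+ M2sum d - (+ 8) *ℤ (+ m₂) *ℤ (+ maxDeg d) ≤ℤ + bEmpty G) × (bEmpty G ≤ M2sum d))
    × (∀ u v w → IsSimple2Path G u v w →
        (+ M2sum d - (+ 4) *ℤ (+ m₂) *ℤ ((+ 2) *ℤ (+ maxDeg d) - (+ 3))
            - (+ 3) *ℤ ((+ maxDeg d) *ℤ (+ maxDeg d) *ℤ (+ maxDeg d)) ≤ℤ + bPath G u v w)
        × (bPath G u v w ≤ M2sum d))
    × (((+ 2) *ℤ (+ m₂) *ℤ (+ Msum d) *ℤ
          (+ Msum d - ((+ 12) *ℤ (+ maxDeg d) *ℤ (+ maxDeg d) - (+ 4) *ℤ (+ maxDeg d) + (+ 8)))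
          ≤ℤ + fd G)
       × (fd G ≤ 2 * m₂ * (Msum d * Msum d)))
lemma4p4 n d m₂ G G∈ hyp =
  let (bEmpty-lower , bEmpty-upper) = bEmpty-estimate
      (fd-lower , fd-upper)         = fd-estimate hyp
  in (bEmpty-ℤ (M2sum d) m₂ Δ (bEmpty G) bEmpty-lower , bEmpty-upper) ,
     (λ u v w path → let (bPath-lower , bPath-upper) = bPath-estimate u v w path
                     in bPath-ℤ (M2sum d) m₂ Δ (bPath G u v w) bPath-lower , bPath-upper) ,
     (fd-ℤ m₂ (Msum d) Δ (fd G) fd-lower , fd-upper)
  where
  open Hypotheses d m₂ G G∈
  Δ = maxDeg d
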